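{- For every integer $k\ge 1$ and every integer $n$ with $2^{k-1}+1\le n\le 2^{k-1}+2^{\lfloor k/2\rfloor}$, there exists a simple series-parallel broadcast graph on $n$ vertices.
   Context: A multigraph is series-parallel (SP) if it can be obtained from $K_2$ by a finite sequence of series extensions (replace an edge $\{x,y\}$ by a new vertex $z$ and edges $\{x,z\},\{z,y\}$) and parallel extensions (add an edge parallel to an existing edge); a simple graph is SP if it is the result of such a sequence with no multiple edges at the end. Broadcasting: initially only an originator holds a message; in each discrete time unit, every informed vertex may inform at most one uninformed neighbor. $b(v,G)$ is the minimum number of time units to inform all vertices from originator $v$, $b(G)=\max_v b(v,G)$, and a connected graph $G$ on $n$ vertices is a broadcast graph if $b(G)=\lceil\log_2 n\rceil$. -}

module Defs where

open import Data.Nat using (ℕ; zero; suc; _<_; _≤_)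
open import Data.Fin using (Fin; fromℕ; inject₁) renaming (zero to f0; suc to fs)
open import Data.Product using (_×_; _,_; ∃; ∃-syntax; Σ)
open import Data.Sum using (_⊎_)
open import Data.List using (List; []; _∷_; map)
open import Data.List.Relation.Unary.Any using (_─_)
open import Data.List.Relation.Unary.All using (All)
open import Data.List.Relation.Unary.AllPairs using (AllPairs)
open import Data.List.Membership.Propositional using (_∈_)
open import Data.Nat.Logarithm using (⌈log₂_⌉)
open import Relation.Binary.PropositionalEquality using (_≡_; _≢_)
open import Relation.Nullary using (¬_)

-- A (loopless) multigraph on vertex set Fin n, given by its list of edges;
-- an edge (x , y) stands for the unordered pair {x , y}; repeated
-- entries (in either orientation) are parallel edges.
Edges : ℕ → Set
Edges n = List (Fin n × Fin n)

-- The new vertex created by a series extension of a graph on Fin n is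
-- fromℕ n (the last vertex of Fin (suc n)); old vertices embed by inject₁.
injEdge : ∀ {n} → Fin n × Fin n → Fin (suc n) × Fin (suc n)
injEdge (x , y) = inject₁ x , inject₁ y

data SP : (n : ℕ) → Edges n → Set where
  base     : SP 2 ((f0 , fs f0) ∷ [])
  series   : ∀ {n E x y} → SP n E → (p : (x , y) ∈ E) →
             SP (suc n) ((inject₁ x , fromℕ n) ∷ (fromℕ n , inject₁ y) ∷ map injEdge (E ─ p))
  parallel : ∀ {n E x y} → SP n E → (x , y) ∈ E → SP n ((x , y) ∷ E)

SameEdge : ∀ {n} → Fin n × Fin n → Fin n × Fin n → Set
SameEdge (x , y) (u , v) = (x ≡ u × y ≡ v) ⊎ (x ≡ v × y ≡ u)

Simple : ∀ {n} → Edges n → Set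
Simple E = All (λ e → Data.Product.proj₁ e ≢ Data.Product.proj₂ e) E
         × AllPairs (λ e f → ¬ SameEdge e f) E

Adj : ∀ {n} → Edges n → Fin n → Fin n → Set
Adj E u w = (u , w) ∈ E ⊎ (w , u) ∈ E

-- A broadcast scheme from originator v finishing within t time units:
-- τ w is the time unit in which w becomes informed (τ v = 0), and
-- π w is the neighbour that informs w; the informer must be informed
-- strictly earlier, and an informer calls at most one vertex per time unit.
BroadcastsWithin : ∀ {n} → Edges n → Fin n → ℕ → Set
BroadcastsWithin {n} E v t =
  Σ (Fin n → ℕ) λ τ → Σ (Fin n → Fin n) λ π →
    (τ v ≡ 0)
  × (∀ w → τ w ≤ t)
  × (∀ w → w ≢ v → Adj E (π w) w × τ (π w) < τ w)
  × (∀ w w′ → w ≢ v → w′ ≢ v → w ≢ w′ → π w ≡ π w′ → τ w ≢ τ w′)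

BroadcastTimeFrom : ∀ {n} → Edges n → Fin n → ℕ → Set
BroadcastTimeFrom E v t = BroadcastsWithin E v t × (∀ s → s < t → ¬ BroadcastsWithin E v s)

-- b(G) = t : t = max over v of b(v,G).
BroadcastTime : ∀ {n} → Edges n → ℕ → Set
BroadcastTime {n} E t = (∀ v → BroadcastsWithin E v t)
                      × ∃[ v ] BroadcastTimeFrom E v t

data Reach {n} (E : Edges n) : Fin n → Fin n → Set where
  here : ∀ {u} → Reach E u u
  step : ∀ {u w z} → Adj E u w → Reach E w z → Reach E u z

Connected : ∀ {n} → Edges n → Set
Connected {n} E = ∀ (u w : Fin n) → Reach E u w

IsBroadcastGraph : ∀ {n} → Edges n → Set
IsBroadcastGraph {n} E = Connected E × BroadcastTime E ⌈log₂ n ⌉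

module Submission where

open import Defs
open import Data.Nat
  using (ℕ; zero; suc; pred; _+_; _^_; _∸_; _/_; _≤_; _<_; _<?_; _≤?_; _≟_; z≤n; s≤s; ⌈_/2⌉; >-nonZero)
open import Data.Nat.Properties
open import Data.Nat.DivMod using (m/n*n≤m)
open import Data.Nat.ListAction using (sum)
open import Data.Nat.Logarithm using (⌈log₂_⌉; ⌈log₂⌉-mono-≤; ⌈log₂2^n⌉≡n; ⌈log₂⌈n/2⌉⌉≡⌈log₂n⌉∸1)
open import Data.Fin using (Fin; toℕ; fromℕ<; fromℕ; inject₁) renaming (zero to f0; suc to fs; _≟_ to _≟ᶠ_)
open import Data.Fin.Properties
  using (toℕ-injective; toℕ<n; toℕ-fromℕ<; toℕ-fromℕ; toℕ-inject₁; fromℕ≢inject₁; inject₁-injective; pigeonhole)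
open import Data.Fin.Relation.Unary.Top using (view; ‵fromℕ; ‵inj₁)
open import Data.List using (List; []; _∷_; _++_; length; [_]; map)
open import Data.List.Properties using (++-assoc; length-++; map-++)
open import Data.List.Relation.Unary.All as All using (All; []; _∷_)
import Data.List.Relation.Unary.All.Properties as All
open import Data.List.Relation.Unary.AllPairs as AllPairs using ([]; _∷_)
import Data.List.Relation.Unary.AllPairs.Properties as AllPairs
open import Data.List.Relation.Unary.Any using (here; there)
open import Data.List.Relation.Unary.Unique.Propositional using (Unique)
open import Data.List.Membership.Propositional using (_∈_; _∉_)
open import Data.List.Membership.Propositional.Properties using (∈-map⁺; ∈-map⁻; ∈-++⁻; ∈-++⁺ˡ; ∈-++⁺ʳ)
open import Data.List.Relation.Binary.Permutation.Propositional
  using (_↭_; ↭-refl; ↭-sym; ↭-trans; ↭-reflexive; prep; ↭⇒↭ₛ; module PermutationReasoning)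
open import Data.List.Relation.Binary.Permutation.Propositional.Properties
  using (++⁺; ++⁺ˡ; ++⁺ʳ; ++-comm; shift; ∈-resp-↭; ++-commutativeMonoid)
import Data.List.Relation.Binary.Permutation.Setoid.Properties as PermutationSetoid
open import Data.List.Relation.Binary.Sublist.Propositional using (_⊆_; ⊆-refl; []; _∷_; _∷ʳ_)
import Data.List.Relation.Binary.Sublist.Propositional.Properties as Sublist
open import Data.Product using (_×_; _,_; ∃-syntax; proj₁; proj₂)
open import Data.Sum using (_⊎_; inj₁; inj₂; swap)
open import Data.Unit using (⊤; tt)
open import Data.Empty using (⊥)
open import Function using (_∘_)
open import Relation.Binary.Definitions using (Symmetric; tri<; tri≈; tri>)
open import Relation.Binary.Construct.Closure.Symmetric using (SymClosure; fwd; bwd; symmetric)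
open import Relation.Nullary using (yes; no; ¬_; contradiction)
open import Relation.Nullary.Decidable using (toSum)
open import Relation.Binary.PropositionalEquality hiding ([_])
import Algebra.Solver.CommutativeMonoid

-- Write k = K + 1, M = ⌊k/2⌋ and n = 1 + 2 ^ K + s with s < 2 ^ M.  The
-- graph has a hub 0 adjacent to all vertices; the others are cut into
-- consecutive blocks, the core [1, 1 + 2 ^ K) followed by one block of
-- size 2 ^ e for each binary digit e of s, each spanned by a binomial tree
-- whose root hangs from vertex 1.  Every vertex i ≥ 2 is thus joined to 0
-- and to one earlier vertex, i.e. obtained by subdividing a parallel copy
-- of an edge at 0, so the graph is series-parallel.
--
-- From the hub, the binomial trees are broadcast in K + 1 rounds.  Any
-- other originator first calls the hub.  A core vertex then informs its
-- own block of size 2 ^ M, a binomial tree re-rooted at it, which takes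
-- 2M − 1 ≤ K rounds; a vertex of an extra block re-roots its block and
-- appends a bottom block of the core reached through vertex 1.  Meanwhile
-- the hub informs, in K rounds, the halves of the core left aside and the
-- remaining extra blocks.  No graph does better than ⌈log₂ n⌉, since a
-- broadcast finishing in t rounds reaches at most 2 ^ t vertices.

2^suc : ∀ e → 2 ^ suc e ≡ 2 ^ e + 2 ^ e
2^suc e = cong (2 ^ e +_) (+-identityʳ (2 ^ e))

2^<2^suc : ∀ e → 2 ^ e < 2 ^ suc e
2^<2^suc e = ≤-trans (m<m+n (2 ^ e) (m^n>0 2 e)) (≤-reflexive (sym (2^suc e)))

2^+-< : ∀ {a b x} y → a < b → x < 2 ^ a → 2 ^ a + x < 2 ^ b + y
2^+-< {a} {b} {x} y a<b x<2^a = begin-strict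
  2 ^ a + x     <⟨ +-monoʳ-< (2 ^ a) x<2^a ⟩
  2 ^ a + 2 ^ a ≡⟨ sym (2^suc a) ⟩
  2 ^ suc a     ≤⟨ ^-monoʳ-≤ 2 a<b ⟩
  2 ^ b         ≤⟨ m≤m+n (2 ^ b) y ⟩
  2 ^ b + y     ∎
  where open ≤-Reasoning

2^+-injectiveˡ : ∀ a b {x y} → x < 2 ^ a → y < 2 ^ b → 2 ^ a + x ≡ 2 ^ b + y → a ≡ b
2^+-injectiveˡ a b {x} {y} x<2^a y<2^b eq with <-cmp a b
... | tri< a<b _ _ = contradiction eq (<⇒≢ (2^+-< y a<b x<2^a))
... | tri≈ _ a≡b _ = a≡b
... | tri> _ _ b<a = contradiction (sym eq) (<⇒≢ (2^+-< x b<a y<2^b))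

2^pred+2^pred : ∀ {t} → 1 ≤ t → 2 ^ pred t + 2 ^ pred t ≡ 2 ^ t
2^pred+2^pred {suc t} _ = sym (2^suc t)

m+m≤1+n⇒m≤n : ∀ m {n} → m + m ≤ suc n → m ≤ n
m+m≤1+n⇒m≤n zero    _            = z≤n
m+m≤1+n⇒m≤n (suc m) (s≤s m+1+m≤n) = m+n≤o⇒n≤o m m+1+m≤n

⌈log₂[1+2^k]⌉≡1+k : ∀ k → ⌈log₂ (1 + 2 ^ k) ⌉ ≡ suc k
⌈log₂[1+2^k]⌉≡1+k zero    = ⌈log₂2^n⌉≡n 1
⌈log₂[1+2^k]⌉≡1+k (suc k) = ∸1≡suc⇒ (begin
  ⌈log₂ (1 + 2 ^ suc k) ⌉ ∸ 1       ≡⟨ sym (⌈log₂⌈n/2⌉⌉≡⌈log₂n⌉∸1 (1 + 2 ^ suc k)) ⟩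
  ⌈log₂ ⌈ 1 + 2 ^ suc k /2⌉ ⌉       ≡⟨ cong (λ m → ⌈log₂ ⌈ 1 + m /2⌉ ⌉) (2^suc k) ⟩
  ⌈log₂ ⌈ 1 + (2 ^ k + 2 ^ k) /2⌉ ⌉ ≡⟨ cong (λ m → ⌈log₂ suc m ⌉) (sym (n≡⌊n+n/2⌋ (2 ^ k))) ⟩
  ⌈log₂ (1 + 2 ^ k) ⌉               ≡⟨ ⌈log₂[1+2^k]⌉≡1+k k ⟩
  suc k                             ∎)
  where
  open ≡-Reasoning
  ∸1≡suc⇒ : ∀ {a b} → a ∸ 1 ≡ suc b → a ≡ suc (suc b)
  ∸1≡suc⇒ {suc a} = cong suc

⌈log₂⌉-exact : ∀ k {n} → 2 ^ k < n → n ≤ 2 ^ suc k → ⌈log₂ n ⌉ ≡ suc k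
⌈log₂⌉-exact k {n} 2^k<n n≤2^1+k = ≤-antisym
  (≤-trans (⌈log₂⌉-mono-≤ n≤2^1+k) (≤-reflexive (⌈log₂2^n⌉≡n (suc k))))
  (≤-trans (≤-reflexive (sym (⌈log₂[1+2^k]⌉≡1+k k))) (⌈log₂⌉-mono-≤ 2^k<n))

module ↭-Solver = Algebra.Solver.CommutativeMonoid (++-commutativeMonoid {A = ℕ})
open ↭-Solver using (_⊕_; _⊜_)

range : ℕ → ℕ → List ℕ
range o zero    = []
range o (suc l) = o ∷ range (suc o) l

range-++ : ∀ o a b → range o (a + b) ≡ range o a ++ range (o + a) b
range-++ o zero    b = cong (λ o′ → range o′ b) (sym (+-identityʳ o))
range-++ o (suc a) b = cong (o ∷_) (trans (range-++ (suc o) a b) (cong (λ o′ → range (suc o) a ++ range o′ b) (sym (+-suc o a))))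

range-2^suc : ∀ o e → range o (2 ^ suc e) ≡ range o (2 ^ e) ++ range (o + 2 ^ e) (2 ^ e)
range-2^suc o e = trans (cong (range o) (2^suc e)) (range-++ o (2 ^ e) (2 ^ e))

∈-range⁺ : ∀ {o l i} → o ≤ i → i < o + l → i ∈ range o l
∈-range⁺ {o} {zero}  o≤i i<o+l = contradiction (≤-trans i<o+l (≤-reflexive (+-identityʳ o))) (≤⇒≯ o≤i)
∈-range⁺ {o} {suc l} {i} o≤i i<o+l with o ≟ i
... | yes refl = here refl
... | no o≢i  = there (∈-range⁺ (≤∧≢⇒< o≤i o≢i) (≤-trans i<o+l (≤-reflexive (+-suc o l))))

∈-range⁻ : ∀ {o l i} → i ∈ range o l → o ≤ i × i < o + l
∈-range⁻ {o} {suc l} (here refl) = ≤-refl , ≤-trans (s≤s (m≤m+n o l)) (≤-reflexive (sym (+-suc o l)))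
∈-range⁻ {o} {suc l} (there i∈) with ∈-range⁻ i∈
... | o<i , i<o+l = <⇒≤ o<i , ≤-trans i<o+l (≤-reflexive (sym (+-suc o l)))

range-unique : ∀ o l → Unique (range o l)
range-unique o zero    = []
range-unique o (suc l) = All.tabulate (λ i∈ → <⇒≢ (proj₁ (∈-range⁻ i∈))) ∷ range-unique (suc o) l

Unique-resp-↭ : ∀ {xs ys : List ℕ} → xs ↭ ys → Unique xs → Unique ys
Unique-resp-↭ = PermutationSetoid.Unique-resp-↭ (setoid ℕ) ∘ ↭⇒↭ₛ

unique-++⁻ : ∀ (xs : List ℕ) {ys} → Unique (xs ++ ys) → Unique xs × Unique ys × (∀ {a} → a ∈ xs → a ∉ ys)
unique-++⁻ []       u = [] , u , λ ()
unique-++⁻ (x ∷ xs) (x∉ ∷ u) with unique-++⁻ xs u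
... | uxs , uys , disjoint =
  All.++⁻ˡ xs x∉ ∷ uxs , uys , λ { (here refl) a∈ys → All.lookup (All.++⁻ʳ xs x∉) a∈ys refl
                                 ; (there a∈xs) → disjoint a∈xs }

unique-map-injective : ∀ {A : Set} (f : A → ℕ) {xs} → Unique (map f xs) →
                       ∀ {a b} → a ∈ xs → b ∈ xs → f a ≡ f b → a ≡ b
unique-map-injective f (_ ∷ _) (here refl) (here refl) _ = refl
unique-map-injective f (fa∉ ∷ _) (here refl) (there b∈) eq = contradiction eq (All.lookup fa∉ (∈-map⁺ f b∈))
unique-map-injective f (fb∉ ∷ _) (there a∈) (here refl) eq = contradiction (sym eq) (All.lookup fb∉ (∈-map⁺ f a∈))
unique-map-injective f (_ ∷ u) (there a∈) (there b∈) eq = unique-map-injective f u a∈ b∈ eq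

-- Broadcast trees

data Tree : Set where
  node : ℕ → List Tree → Tree

Forest : Set
Forest = List Tree

root : Tree → ℕ
root (node x _) = x

mutual
  labels : Tree → List ℕ
  labels (node x ts) = x ∷ labelsᶠ ts

  labelsᶠ : Forest → List ℕ
  labelsᶠ []       = []
  labelsᶠ (t ∷ ts) = labels t ++ labelsᶠ ts

labelsᶠ-++ : ∀ ts us → labelsᶠ (ts ++ us) ≡ labelsᶠ ts ++ labelsᶠ us
labelsᶠ-++ []       us = refl
labelsᶠ-++ (t ∷ ts) us = trans (cong (labels t ++_) (labelsᶠ-++ ts us)) (sym (++-assoc (labels t) (labelsᶠ ts) (labelsᶠ us)))

-- A tree is read as a broadcast: a node informed in round t calls its
-- i-th child in round t + i.
mutual
  FinishesBy : ℕ → Tree → Set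
  FinishesBy t (node _ ts) = FinishesByᶠ t ts

  FinishesByᶠ : ℕ → Forest → Set
  FinishesByᶠ _       []       = ⊤
  FinishesByᶠ zero    (_ ∷ _)  = ⊥
  FinishesByᶠ (suc t) (u ∷ us) = FinishesBy t u × FinishesByᶠ t us

mutual
  finishesBy-mono : ∀ {t t′} T → t ≤ t′ → FinishesBy t T → FinishesBy t′ T
  finishesBy-mono (node _ ts) = finishesByᶠ-mono ts

  finishesByᶠ-mono : ∀ {t t′} ts → t ≤ t′ → FinishesByᶠ t ts → FinishesByᶠ t′ ts
  finishesByᶠ-mono []                   _          _          = tt
  finishesByᶠ-mono {zero}  (_ ∷ _)      _          ()
  finishesByᶠ-mono {suc _} {suc _} (u ∷ us) (s≤s t≤t′) (fu , fus) =
    finishesBy-mono u t≤t′ fu , finishesByᶠ-mono us t≤t′ fus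

finishesByᶠ-++ : ∀ {t r} us {vs} → FinishesByᶠ t us → FinishesByᶠ r vs → length us + r ≤ t → FinishesByᶠ t (us ++ vs)
finishesByᶠ-++         []       _          fvs r≤t       = finishesByᶠ-mono _ r≤t fvs
finishesByᶠ-++ {zero}  (_ ∷ _)  ()         _   _
finishesByᶠ-++ {suc t} (u ∷ us) (fu , fus) fvs (s≤s len) = fu , finishesByᶠ-++ us fus fvs len

-- Dropping calls only brings the remaining ones forward.
finishesByᶠ-⊆ : ∀ {t ts us} → ts ⊆ us → FinishesByᶠ t us → FinishesByᶠ t ts
finishesByᶠ-⊆                     []             _          = tt
finishesByᶠ-⊆ {zero}  {us = _ ∷ _} (_ ∷ʳ _)      ()
finishesByᶠ-⊆ {zero}  {us = _ ∷ _} (_ ∷ _)       ()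
finishesByᶠ-⊆ {suc t} {us = u ∷ us} (.u ∷ʳ ts⊆us) (_ , fus)  = finishesByᶠ-mono _ (n≤1+n t) (finishesByᶠ-⊆ ts⊆us fus)
finishesByᶠ-⊆ {suc t} {us = u ∷ us} (refl ∷ ts⊆us) (fu , fus) = fu , finishesByᶠ-⊆ ts⊆us fus

data EdgesIn (R : ℕ → ℕ → Set) : Tree → Set where
  node : ∀ {x ts} → All (R x ∘ root) ts → All (EdgesIn R) ts → EdgesIn R (node x ts)

addFirstChild : Tree → Tree → Tree
addFirstChild h (node x ts) = node x (h ∷ ts)

labels-addFirstChild : ∀ h T → labels (addFirstChild h T) ↭ labels h ++ labels T
labels-addFirstChild h (node x ts) = ↭-sym (shift x (labels h) (labelsᶠ ts))

finishesBy-addFirstChild : ∀ {t} h T → FinishesBy t h → FinishesBy t T → FinishesBy (suc t) (addFirstChild h T)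
finishesBy-addFirstChild h (node x ts) fh fT = fh , fT

edgesIn-addFirstChild : ∀ {R} h T → R (root T) (root h) → EdgesIn R h → EdgesIn R T → EdgesIn R (addFirstChild h T)
edgesIn-addFirstChild h (node x ts) Rxh Eh (node Rts Ets) = node (Rxh ∷ Rts) (Eh ∷ Ets)

root-addFirstChild : ∀ h T → root (addFirstChild h T) ≡ root T
root-addFirstChild h (node x ts) = refl

record Call : Set where
  constructor call
  field
    vertex informer round : ℕ
open Call

mutual
  schedule : ℕ → ℕ → Tree → List Call
  schedule t p (node x ts) = call x p t ∷ scheduleᶠ t x ts

  scheduleᶠ : ℕ → ℕ → Forest → List Call
  scheduleᶠ t x []       = []
  scheduleᶠ t x (u ∷ us) = schedule (suc t) x u ++ scheduleᶠ (suc t) x us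

mutual
  map-vertex-schedule : ∀ t p T → map vertex (schedule t p T) ≡ labels T
  map-vertex-schedule t p (node x ts) = cong (x ∷_) (map-vertex-scheduleᶠ t x ts)

  map-vertex-scheduleᶠ : ∀ t x ts → map vertex (scheduleᶠ t x ts) ≡ labelsᶠ ts
  map-vertex-scheduleᶠ t x []       = refl
  map-vertex-scheduleᶠ t x (u ∷ us) =
    trans (map-++ vertex (schedule (suc t) x u) _)
          (cong₂ _++_ (map-vertex-schedule (suc t) x u) (map-vertex-scheduleᶠ (suc t) x us))

mutual
  schedule-round≤ : ∀ {b t p} T → FinishesBy b T → ∀ {c} → c ∈ schedule t p T → round c ≤ t + b
  schedule-round≤ (node x ts) _   (here refl) = m≤m+n _ _
  schedule-round≤ (node x ts) fin (there c∈)  = scheduleᶠ-round≤ ts fin c∈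

  scheduleᶠ-round≤ : ∀ {b t x} ts → FinishesByᶠ b ts → ∀ {c} → c ∈ scheduleᶠ t x ts → round c ≤ t + b
  scheduleᶠ-round≤ {zero}          (u ∷ us) ()         _
  scheduleᶠ-round≤ {suc b} {t} {x} (u ∷ us) (fu , fus) c∈ with ∈-++⁻ (schedule (suc t) x u) c∈
  ... | inj₁ c∈u  = ≤-trans (schedule-round≤ u fu c∈u) (≤-reflexive (sym (+-suc t b)))
  ... | inj₂ c∈us = ≤-trans (scheduleᶠ-round≤ us fus c∈us) (≤-reflexive (sym (+-suc t b)))

mutual
  schedule-round≥ : ∀ {t p} T {c} → c ∈ schedule t p T → t ≤ round c
  schedule-round≥ (node x ts) (here refl) = ≤-refl
  schedule-round≥ (node x ts) (there c∈)  = <⇒≤ (scheduleᶠ-round> ts c∈)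

  scheduleᶠ-round> : ∀ {t x} ts {c} → c ∈ scheduleᶠ t x ts → t < round c
  scheduleᶠ-round> {t} {x} (u ∷ us) c∈ with ∈-++⁻ (schedule (suc t) x u) c∈
  ... | inj₁ c∈u  = schedule-round≥ u c∈u
  ... | inj₂ c∈us = <⇒≤ (scheduleᶠ-round> us c∈us)

mutual
  schedule-informer : ∀ {t p} T {c} → c ∈ schedule t p T → informer c ≡ p ⊎ informer c ∈ labels T
  schedule-informer (node x ts) (here refl) = inj₁ refl
  schedule-informer (node x ts) (there c∈)  = inj₂ (scheduleᶠ-informer ts c∈)

  scheduleᶠ-informer : ∀ {t x} ts {c} → c ∈ scheduleᶠ t x ts → informer c ∈ x ∷ labelsᶠ ts
  scheduleᶠ-informer {t} {x} (u ∷ us) c∈ with ∈-++⁻ (schedule (suc t) x u) c∈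
  ... | inj₁ c∈u with schedule-informer u c∈u
  ...   | inj₁ refl = here refl
  ...   | inj₂ p∈u  = there (∈-++⁺ˡ p∈u)
  scheduleᶠ-informer {t} {x} (u ∷ us) c∈ | inj₂ c∈us with scheduleᶠ-informer us c∈us
  ...   | here p≡x = here p≡x
  ...   | there p∈ = there (∈-++⁺ʳ (labels u) p∈)

scheduleᶠ-informed : ∀ {R t x ts} → All (R x ∘ root) ts → All (EdgesIn R) ts →
  ∀ {c} → c ∈ scheduleᶠ t x ts →
  R (informer c) (vertex c) ×
  (informer c ≡ x ⊎ ∃[ c′ ] c′ ∈ scheduleᶠ t x ts × vertex c′ ≡ informer c × round c′ < round c)
scheduleᶠ-informed {t = t} {x} {node y vs ∷ us} (Rxy ∷ Rxus) (node Ryvs Evs ∷ Eus) c∈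
  with ∈-++⁻ (schedule (suc t) x (node y vs)) c∈
... | inj₁ (here refl) = Rxy , inj₁ refl
... | inj₁ (there c∈vs) with scheduleᶠ-informed Ryvs Evs c∈vs
...   | Rpc , inj₁ refl = Rpc , inj₂ (call y x (suc t) , here refl , refl , scheduleᶠ-round> vs c∈vs)
...   | Rpc , inj₂ (c′ , c′∈ , eq , lt) = Rpc , inj₂ (c′ , there (∈-++⁺ˡ c′∈) , eq , lt)
scheduleᶠ-informed {t = t} {x} {node y vs ∷ us} (Rxy ∷ Rxus) (node Ryvs Evs ∷ Eus) c∈
  | inj₂ c∈us with scheduleᶠ-informed Rxus Eus c∈us
...   | Rpc , inj₁ p≡x = Rpc , inj₁ p≡x
...   | Rpc , inj₂ (c′ , c′∈ , eq , lt) = Rpc , inj₂ (c′ , ∈-++⁺ʳ (schedule (suc t) x (node y vs)) c′∈ , eq , lt)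

scheduleᶠ-slot-injective : ∀ t x ts → Unique (x ∷ labelsᶠ ts) →
  ∀ {c c′} → c ∈ scheduleᶠ t x ts → c′ ∈ scheduleᶠ t x ts →
  informer c ≡ informer c′ → round c ≡ round c′ → vertex c ≡ vertex c′
scheduleᶠ-slot-injective t x (node y vs ∷ us) u c∈ c′∈ p≡ r≡
  with unique-++⁻ (y ∷ labelsᶠ vs) (Unique-resp-↭ (↭-sym (shift x (y ∷ labelsᶠ vs) (labelsᶠ us))) u)
     | ∈-++⁻ (schedule (suc t) x (node y vs)) c∈ | ∈-++⁻ (schedule (suc t) x (node y vs)) c′∈
... | _ | inj₁ (here refl) | inj₁ (here refl) = refl
... | _ | inj₁ (here refl) | inj₁ (there d∈) = contradiction r≡ (<⇒≢ (scheduleᶠ-round> vs d∈))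
... | _ | inj₁ (there d∈) | inj₁ (here refl) = contradiction (sym r≡) (<⇒≢ (scheduleᶠ-round> vs d∈))
... | _ | inj₁ (here refl) | inj₂ d∈ = contradiction r≡ (<⇒≢ (scheduleᶠ-round> us d∈))
... | _ | inj₂ d∈ | inj₁ (here refl) = contradiction (sym r≡) (<⇒≢ (scheduleᶠ-round> us d∈))
... | uvs , _ , _ | inj₁ (there d∈) | inj₁ (there d′∈) = scheduleᶠ-slot-injective (suc t) y vs uvs d∈ d′∈ p≡ r≡
... | _ , uus , _ | inj₂ d∈ | inj₂ d′∈ = scheduleᶠ-slot-injective (suc t) x us uus d∈ d′∈ p≡ r≡
... | _ , _ , disjoint | inj₁ (there d∈) | inj₂ d′∈ =
  contradiction (subst (_∈ x ∷ labelsᶠ us) (sym p≡) (scheduleᶠ-informer us d′∈)) (disjoint (scheduleᶠ-informer vs d∈))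
... | _ , _ , disjoint | inj₂ d∈ | inj₁ (there d′∈) =
  contradiction (subst (_∈ x ∷ labelsᶠ us) p≡ (scheduleᶠ-informer us d∈)) (disjoint (scheduleᶠ-informer vs d′∈))

module _ {n : ℕ} (E : Edges n) {R : ℕ → ℕ → Set}
         (R⇒Adj : ∀ {u w : Fin n} → u ≢ w → R (toℕ u) (toℕ w) → Adj E u w) where

  broadcastTree⇒broadcastsWithin : ∀ {T t} → labels T ↭ range 0 n → EdgesIn R T → FinishesBy t T →
                                   ∀ v → toℕ v ≡ root T → BroadcastsWithin E v t
  broadcastTree⇒broadcastsWithin {node r ts} {t} labels↭ (node Rr Ets) fin v v≡r =
    τ , π , τ-root , τ≤t , informed , distinct
    where
    T : Tree
    T = node r ts
    -- The originator is recorded as its own informer, so that every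
    -- informer is a vertex.
    S : List Call
    S = schedule 0 r T

    label<n : ∀ {a} → a ∈ labels T → a < n
    label<n a∈ = proj₂ (∈-range⁻ (∈-resp-↭ labels↭ a∈))

    unique-S : Unique (map vertex S)
    unique-S = subst Unique (sym (map-vertex-schedule 0 r T)) (Unique-resp-↭ (↭-sym labels↭) (range-unique 0 n))

    same-call : ∀ {c c′} → c ∈ S → c′ ∈ S → vertex c ≡ vertex c′ → c ≡ c′
    same-call = unique-map-injective vertex unique-S

    callOf : ∀ w → ∃[ c ] c ∈ S × vertex c ≡ toℕ w
    callOf w with ∈-map⁻ vertex (subst (toℕ w ∈_) (sym (map-vertex-schedule 0 r T))
                                        (∈-resp-↭ (↭-sym labels↭) (∈-range⁺ z≤n (toℕ<n w))))
    ... | c , c∈ , w≡c = c , c∈ , sym w≡c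

    informer<n : ∀ {c} → c ∈ S → informer c < n
    informer<n c∈ with schedule-informer T c∈
    ... | inj₁ refl = label<n (here refl)
    ... | inj₂ p∈   = label<n p∈

    τ : Fin n → ℕ
    τ w = round (proj₁ (callOf w))

    π : Fin n → Fin n
    π w = fromℕ< (informer<n (proj₁ (proj₂ (callOf w))))

    callOf-unique : ∀ {w c} → c ∈ S → vertex c ≡ toℕ w → proj₁ (callOf w) ≡ c
    callOf-unique {w} c∈ eq = same-call (proj₁ (proj₂ (callOf w))) c∈ (trans (proj₂ (proj₂ (callOf w))) (sym eq))

    τ-call : ∀ {w c} → c ∈ S → vertex c ≡ toℕ w → τ w ≡ round c
    τ-call c∈ eq = cong round (callOf-unique c∈ eq)

    π-call : ∀ {w c} → c ∈ S → vertex c ≡ toℕ w → toℕ (π w) ≡ informer c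
    π-call c∈ eq = trans (toℕ-fromℕ< _) (cong informer (callOf-unique c∈ eq))

    nonRootCall : ∀ w → w ≢ v → ∃[ c ] c ∈ scheduleᶠ 0 r ts × vertex c ≡ toℕ w
    nonRootCall w w≢v with callOf w
    ... | c , here refl , r≡w = contradiction (toℕ-injective (trans (sym r≡w) (sym v≡r))) w≢v
    ... | c , there c∈ , eq = c , c∈ , eq

    τ-root : τ v ≡ 0
    τ-root = τ-call (here refl) (sym v≡r)

    τ≤t : ∀ w → τ w ≤ t
    τ≤t w = schedule-round≤ T fin (proj₁ (proj₂ (callOf w)))

    informerCall : ∀ {c} → c ∈ scheduleᶠ 0 r ts →
                   R (informer c) (vertex c) × ∃[ c′ ] c′ ∈ S × vertex c′ ≡ informer c × round c′ < round c
    informerCall c∈ with scheduleᶠ-informed Rr Ets c∈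
    ... | Rpc , inj₁ refl = Rpc , call r r 0 , here refl , refl , scheduleᶠ-round> ts c∈
    ... | Rpc , inj₂ (c′ , c′∈ , eq , lt) = Rpc , c′ , there c′∈ , eq , lt

    informed : ∀ w → w ≢ v → Adj E (π w) w × τ (π w) < τ w
    informed w w≢v with nonRootCall w w≢v
    ... | c , c∈ , eq with informerCall c∈
    ...   | Rpc , c′ , c′∈ , c′≡p , lt = R⇒Adj πw≢w Rπww , τπw<τw
      where
      c′≡π : vertex c′ ≡ toℕ (π w)
      c′≡π = trans c′≡p (sym (π-call (there c∈) eq))
      τπw<τw : τ (π w) < τ w
      τπw<τw = subst₂ _<_ (sym (τ-call c′∈ c′≡π)) (sym (τ-call (there c∈) eq)) lt
      πw≢w : π w ≢ w
      πw≢w πw≡w = <⇒≢ τπw<τw (cong τ πw≡w)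
      Rπww : R (toℕ (π w)) (toℕ w)
      Rπww = subst₂ R (sym (π-call (there c∈) eq)) eq Rpc

    distinct : ∀ w w′ → w ≢ v → w′ ≢ v → w ≢ w′ → π w ≡ π w′ → τ w ≢ τ w′
    distinct w w′ w≢v w′≢v w≢w′ πw≡πw′ τw≡τw′ with nonRootCall w w≢v | nonRootCall w′ w′≢v
    ... | c , c∈ , eq | c′ , c′∈ , eq′ = w≢w′ (toℕ-injective (trans (sym eq) (trans same-vertex eq′)))
      where
      unique-r∷ts : Unique (r ∷ labelsᶠ ts)
      unique-r∷ts = Unique-resp-↭ (↭-sym labels↭) (range-unique 0 n)
      same-vertex : vertex c ≡ vertex c′
      same-vertex = scheduleᶠ-slot-injective 0 r ts unique-r∷ts c∈ c′∈
        (trans (sym (π-call (there c∈) eq)) (trans (cong toℕ πw≡πw′) (π-call (there c′∈) eq′)))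
        (trans (sym (τ-call (there c∈) eq)) (trans τw≡τw′ (τ-call (there c′∈) eq′)))

-- Lower bound

module _ {n} {E : Edges n} {v : Fin n} {s : ℕ} (B : BroadcastsWithin E v s) where
  private
    τ : Fin n → ℕ
    τ = proj₁ B

    π : Fin n → Fin n
    π = proj₁ (proj₂ B)

    τ≤s : ∀ w → τ w ≤ s
    τ≤s = proj₁ (proj₂ (proj₂ (proj₂ B)))

    τπ<τ : ∀ w → w ≢ v → τ (π w) < τ w
    τπ<τ w w≢v = proj₂ (proj₁ (proj₂ (proj₂ (proj₂ (proj₂ B)))) w w≢v)

    distinct : ∀ w w′ → w ≢ v → w′ ≢ v → w ≢ w′ → π w ≡ π w′ → τ w ≢ τ w′
    distinct = proj₂ (proj₂ (proj₂ (proj₂ (proj₂ B))))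

    1≤τ : ∀ w → w ≢ v → 1 ≤ τ w
    1≤τ w w≢v = ≤-trans (s≤s z≤n) (τπ<τ w w≢v)

    -- The informers of w, π w, π (π w), … are informed in strictly decreasing
    -- rounds, so the sum of 2 ^ (round − 1) along that chain is a binary
    -- numeral determining w.  The fuel f only has to exceed τ w.
    code : ℕ → Fin n → ℕ
    code zero    _ = 0
    code (suc f) w with w ≟ᶠ v
    ... | yes _ = 0
    ... | no  _ = 2 ^ pred (τ w) + code f (π w)

    code-root : ∀ f → code (suc f) v ≡ 0
    code-root f with v ≟ᶠ v
    ... | yes _ = refl
    ... | no v≢v = contradiction refl v≢v

    code-nonroot : ∀ f {w} → w ≢ v → code (suc f) w ≡ 2 ^ pred (τ w) + code f (π w)
    code-nonroot f {w} w≢v with w ≟ᶠ v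
    ... | yes w≡v = contradiction w≡v w≢v
    ... | no  _   = refl

    mutual
      code-< : ∀ f w → τ w < f → code f w < 2 ^ τ w
      code-< (suc f) w τw<1+f with w ≟ᶠ v
      ... | yes _   = m^n>0 2 (τ w)
      ... | no w≢v = begin-strict
        2 ^ pred (τ w) + code f (π w)     <⟨ +-monoʳ-< (2 ^ pred (τ w)) (informer-code-< f w≢v τw<1+f) ⟩
        2 ^ pred (τ w) + 2 ^ pred (τ w)   ≡⟨ 2^pred+2^pred (1≤τ w w≢v) ⟩
        2 ^ τ w                           ∎
        where open ≤-Reasoning

      informer-code-< : ∀ f {w} → w ≢ v → τ w < suc f → code f (π w) < 2 ^ pred (τ w)
      informer-code-< f {w} w≢v τw<1+f =
        ≤-trans (code-< f (π w) (≤-trans (τπ<τ w w≢v) (≤-pred τw<1+f)))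
                (^-monoʳ-≤ 2 (suc[m]≤n⇒m≤pred[n] (τπ<τ w w≢v)))

    code-positive : ∀ f {w} → w ≢ v → 0 < code (suc f) w
    code-positive f {w} w≢v =
      subst (0 <_) (sym (code-nonroot f w≢v)) (≤-trans (m^n>0 2 (pred (τ w))) (m≤m+n _ (code f (π w))))

    code-injective : ∀ f w w′ → τ w < f → τ w′ < f → code f w ≡ code f w′ → w ≡ w′
    code-injective (suc f) w w′ τw<f τw′<f eq with toSum (w ≟ᶠ v) | toSum (w′ ≟ᶠ v)
    ... | inj₁ w≡v  | inj₁ w′≡v = trans w≡v (sym w′≡v)
    ... | inj₁ refl | inj₂ w′≢v = contradiction (trans (sym eq) (code-root f)) (>⇒≢ (code-positive f w′≢v))
    ... | inj₂ w≢v  | inj₁ refl = contradiction (trans eq (code-root f)) (>⇒≢ (code-positive f w≢v))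
    ... | inj₂ w≢v  | inj₂ w′≢v with w ≟ᶠ w′
    ...   | yes w≡w′ = w≡w′
    ...   | no w≢w′ = contradiction τw≡τw′ (distinct w w′ w≢v w′≢v w≢w′ πw≡πw′)
      where
      eq′ : 2 ^ pred (τ w) + code f (π w) ≡ 2 ^ pred (τ w′) + code f (π w′)
      eq′ = trans (sym (code-nonroot f w≢v)) (trans eq (code-nonroot f w′≢v))
      τw≡τw′ : τ w ≡ τ w′
      τw≡τw′ = pred-injective {{>-nonZero (1≤τ w w≢v)}} {{>-nonZero (1≤τ w′ w′≢v)}}
        (2^+-injectiveˡ (pred (τ w)) (pred (τ w′)) (informer-code-< f w≢v τw<f) (informer-code-< f w′≢v τw′<f) eq′)
      πw≡πw′ : π w ≡ π w′
      πw≡πw′ = code-injective f (π w) (π w′)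
                 (≤-trans (τπ<τ w w≢v) (≤-pred τw<f)) (≤-trans (τπ<τ w′ w′≢v) (≤-pred τw′<f))
                 (+-cancelˡ-≡ _ _ _ (trans eq′ (cong (λ t → 2 ^ pred t + code f (π w′)) (sym τw≡τw′))))

  broadcastsWithin⇒≤2^ : n ≤ 2 ^ s
  broadcastsWithin⇒≤2^ with n ≤? 2 ^ s
  ... | yes n≤2^s = n≤2^s
  ... | no  n≰2^s with pigeonhole (≰⇒> n≰2^s) codeᶠ
    where
    code<2^s : ∀ w → code (suc s) w < 2 ^ s
    code<2^s w = ≤-trans (code-< (suc s) w (s≤s (τ≤s w))) (^-monoʳ-≤ 2 (τ≤s w))
    codeᶠ : Fin n → Fin (2 ^ s)
    codeᶠ w = fromℕ< (code<2^s w)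
  ...   | i , j , i<j , codeᵢ≡codeⱼ =
    contradiction (cong toℕ (code-injective (suc s) i j (s≤s (τ≤s i)) (s≤s (τ≤s j))
                     (trans (sym (toℕ-fromℕ< _)) (trans (cong toℕ codeᵢ≡codeⱼ) (toℕ-fromℕ< _)))))
                  (<⇒≢ i<j)

-- Fan graphs

Link : (ℕ → ℕ) → ℕ → ℕ → Set
Link P a b = a ≡ 0 ⊎ (2 ≤ b × P b ≡ a)

module Fan (P : ℕ → ℕ) (P< : ∀ {i} → 2 ≤ i → P i < i) (1≤P : ∀ {i} → 2 ≤ i → 1 ≤ P i) where

  parentVertex : ∀ m → Fin (2 + m)
  parentVertex m = fromℕ< (P< {2 + m} (s≤s (s≤s z≤n)))

  -- Vertex 2 + m is joined to the hub and to P (2 + m) by subdividing a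
  -- parallel copy of the edge {0, P (2 + m)}.
  fan : ∀ m → Edges (2 + m)
  fan zero    = (f0 , fs f0) ∷ []
  fan (suc m) = (f0 , fromℕ (2 + m)) ∷ (fromℕ (2 + m) , inject₁ (parentVertex m)) ∷ map injEdge (fan m)

  hub-edge : ∀ m (w : Fin (2 + m)) → w ≢ f0 → (f0 , w) ∈ fan m
  hub-edge zero    f0      w≢0 = contradiction refl w≢0
  hub-edge zero    (fs f0) _   = here refl
  hub-edge (suc m) w       w≢0 with view w
  ... | ‵fromℕ           = here refl
  ... | ‵inj₁ {i = w′} _ = there (there (∈-map⁺ injEdge (hub-edge m w′ (w≢0 ∘ cong inject₁))))

  parent-edge : ∀ m (u w : Fin (2 + m)) → 2 ≤ toℕ u → toℕ w ≡ P (toℕ u) → (u , w) ∈ fan m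
  parent-edge zero f0      _ ()        _
  parent-edge zero (fs f0) _ (s≤s ()) _
  parent-edge (suc m) u w 2≤u w≡Pu with view u
  ... | ‵fromℕ = there (here (cong (fromℕ (2 + m) ,_) (toℕ-injective (begin
    toℕ w                           ≡⟨ w≡Pu ⟩
    P (toℕ (fromℕ (2 + m)))         ≡⟨ cong P (toℕ-fromℕ (2 + m)) ⟩
    P (2 + m)                       ≡⟨ sym (toℕ-fromℕ< _) ⟩
    toℕ (parentVertex m)            ≡⟨ sym (toℕ-inject₁ (parentVertex m)) ⟩
    toℕ (inject₁ (parentVertex m))  ∎))))
    where open ≡-Reasoning
  ... | ‵inj₁ {i = u′} _ with view w
  ...   | ‵fromℕ = contradiction (begin-strict
          2 + m                      ≡⟨ sym (toℕ-fromℕ (2 + m)) ⟩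
          toℕ (fromℕ (2 + m))        ≡⟨ w≡Pu ⟩
          P (toℕ (inject₁ u′))       <⟨ P< 2≤u ⟩
          toℕ (inject₁ u′)           ≡⟨ toℕ-inject₁ u′ ⟩
          toℕ u′                     <⟨ toℕ<n u′ ⟩
          2 + m                      ∎) (<-irrefl refl)
    where open ≤-Reasoning
  ...   | ‵inj₁ {i = w′} _ = there (there (∈-map⁺ injEdge (parent-edge m u′ w′
          (subst (2 ≤_) (toℕ-inject₁ u′) 2≤u)
          (trans (sym (toℕ-inject₁ w′)) (trans w≡Pu (cong P (toℕ-inject₁ u′)))))))

  parentVertex≢0 : ∀ m → parentVertex m ≢ f0
  parentVertex≢0 m p≡0 = <⇒≢ (1≤P {2 + m} (s≤s (s≤s z≤n))) (sym (trans (sym (toℕ-fromℕ< _)) (cong toℕ p≡0)))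

  fan-SP : ∀ m → SP (2 + m) (fan m)
  fan-SP zero    = base
  fan-SP (suc m) = series (parallel (fan-SP m) (hub-edge m (parentVertex m) (parentVertex≢0 m))) (here refl)

  fan-simple : ∀ m → Simple (fan m)
  fan-simple zero    = ((λ ()) ∷ []) , ([] ∷ [])
  fan-simple (suc m) with fan-simple m
  ... | loopless , nonparallel =
    ((λ ()) ∷ fromℕ≢inject₁ ∷ All.map⁺ (All.map (_∘ inject₁-injective) loopless)) ,
    ((new₁≁new₂ ∷ All.map⁺ (All.tabulate (λ _ → new₁≁old))) ∷
     All.map⁺ (All.tabulate (λ _ → new₂≁old)) ∷
     AllPairs.map⁺ (AllPairs.map old≁old nonparallel))
    where
    N p : Fin (3 + m)
    N = fromℕ (2 + m)
    p = inject₁ (parentVertex m)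
    new₁≁new₂ : ¬ SameEdge (f0 , N) (N , p)
    new₁≁new₂ (inj₁ (() , _))
    new₁≁new₂ (inj₂ (0≡p , _)) = parentVertex≢0 m (inject₁-injective (sym 0≡p))
    new₁≁old : ∀ {e} → ¬ SameEdge (f0 , N) (injEdge e)
    new₁≁old (inj₁ (_ , N≡y)) = fromℕ≢inject₁ N≡y
    new₁≁old (inj₂ (_ , N≡x)) = fromℕ≢inject₁ N≡x
    new₂≁old : ∀ {e} → ¬ SameEdge (N , p) (injEdge e)
    new₂≁old (inj₁ (N≡x , _)) = fromℕ≢inject₁ N≡x
    new₂≁old (inj₂ (N≡y , _)) = fromℕ≢inject₁ N≡y
    old≁old : ∀ {e f} → ¬ SameEdge e f → ¬ SameEdge (injEdge e) (injEdge f)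
    old≁old e≁f (inj₁ (x≡ , y≡)) = e≁f (inj₁ (inject₁-injective x≡ , inject₁-injective y≡))
    old≁old e≁f (inj₂ (x≡ , y≡)) = e≁f (inj₂ (inject₁-injective x≡ , inject₁-injective y≡))

  fan-connected : ∀ m → Connected (fan m)
  fan-connected m u w = toHub u (fromHub w)
    where
    fromHub : ∀ z → Reach (fan m) f0 z
    fromHub f0     = here
    fromHub (fs z) = step (inj₁ (hub-edge m (fs z) (λ ()))) here
    toHub : ∀ z → Reach (fan m) f0 w → Reach (fan m) z w
    toHub f0     r = r
    toHub (fs z) r = step (inj₂ (hub-edge m (fs z) (λ ()))) r

  link⇒adj : ∀ m {u w : Fin (2 + m)} → u ≢ w → Link P (toℕ u) (toℕ w) → Adj (fan m) u w
  link⇒adj m {u} {w} u≢w (inj₁ u≡0) with toℕ-injective {i = u} {j = f0} u≡0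
  ... | refl = inj₁ (hub-edge m w (u≢w ∘ sym))
  link⇒adj m {u} {w} _ (inj₂ (2≤w , Pw≡u)) = inj₂ (parent-edge m w u 2≤w (sym Pw≡u))

  symLink⇒adj : ∀ m {u w : Fin (2 + m)} → u ≢ w → SymClosure (Link P) (toℕ u) (toℕ w) → Adj (fan m) u w
  symLink⇒adj m u≢w (fwd l) = link⇒adj m u≢w l
  symLink⇒adj m u≢w (bwd l) = swap (link⇒adj m (u≢w ∘ sym) l)

-- Binomial trees

-- R contains the edges of the binomial tree on [x, x + 2 ^ e) rooted at x.
BinomialBlock : (ℕ → ℕ → Set) → ℕ → ℕ → Set
BinomialBlock R x zero    = ⊤
BinomialBlock R x (suc e) = R x (x + 2 ^ e) × BinomialBlock R x e × BinomialBlock R (x + 2 ^ e) e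

mutual
  binomial : ℕ → ℕ → Tree
  binomial x e = node x (binomialChildren x e)

  binomialChildren : ℕ → ℕ → Forest
  binomialChildren x zero    = []
  binomialChildren x (suc e) = binomial (x + 2 ^ e) e ∷ binomialChildren x e

labels-binomial : ∀ x e → labels (binomial x e) ↭ range x (2 ^ e)
labels-binomial x zero    = ↭-refl
labels-binomial x (suc e) = begin
  x ∷ labels (binomial (x + 2 ^ e) e) ++ labelsᶠ (binomialChildren x e)
    ↭⟨ ↭-sym (shift x (labels (binomial (x + 2 ^ e) e)) _) ⟩
  labels (binomial (x + 2 ^ e) e) ++ labels (binomial x e)
    ↭⟨ ++⁺ (labels-binomial (x + 2 ^ e) e) (labels-binomial x e) ⟩
  range (x + 2 ^ e) (2 ^ e) ++ range x (2 ^ e)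
    ↭⟨ ++-comm (range (x + 2 ^ e) (2 ^ e)) _ ⟩
  range x (2 ^ e) ++ range (x + 2 ^ e) (2 ^ e)
    ≡⟨ sym (range-2^suc x e) ⟩
  range x (2 ^ suc e) ∎
  where open PermutationReasoning

finishesBy-binomial : ∀ x e → FinishesBy e (binomial x e)
finishesBy-binomial x zero    = tt
finishesBy-binomial x (suc e) = finishesBy-binomial (x + 2 ^ e) e , finishesBy-binomial x e

edgesIn-binomial : ∀ {R} x e → BinomialBlock R x e → EdgesIn R (binomial x e)
edgesIn-binomial x zero    _ = node [] []
edgesIn-binomial x (suc e) (link , lower , upper) with edgesIn-binomial x e lower
... | node Rch Ech = node (link ∷ Rch) (edgesIn-binomial (x + 2 ^ e) e upper ∷ Ech)

-- The binomial tree on [x, x + 2 ^ e) re-rooted at v, with the extra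
-- children us appended to x.
reroot : ℕ → ℕ → ℕ → Forest → Tree
reroot x zero    v us = node x us
reroot x (suc e) v us with x + 2 ^ e ≤? v
... | yes _ = reroot (x + 2 ^ e) e v [ node x (us ++ binomialChildren x e) ]
... | no  _ = reroot x e v (us ++ [ binomial (x + 2 ^ e) e ])

<-upper-half : ∀ x e {v} → v < x + 2 ^ suc e → v < (x + 2 ^ e) + 2 ^ e
<-upper-half x e v< = ≤-trans v< (≤-reflexive (trans (cong (x +_) (2^suc e)) (sym (+-assoc x _ _))))

root-reroot : ∀ x e v us → x ≤ v → v < x + 2 ^ e → root (reroot x e v us) ≡ v
root-reroot x zero    v us x≤v v<x+1 = ≤-antisym x≤v (≤-pred (≤-trans v<x+1 (≤-reflexive (+-comm x 1))))
root-reroot x (suc e) v us x≤v v< with x + 2 ^ e ≤? v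
... | yes x+2^e≤v = root-reroot (x + 2 ^ e) e v _ x+2^e≤v (<-upper-half x e v<)
... | no  x+2^e≰v = root-reroot x e v _ x≤v (≰⇒> x+2^e≰v)

labels-reroot : ∀ x e v us → labels (reroot x e v us) ↭ range x (2 ^ e) ++ labelsᶠ us
labels-reroot x zero    v us = ↭-refl
labels-reroot x (suc e) v us with x + 2 ^ e ≤? v
... | yes _ = begin
  labels (reroot (x + 2 ^ e) e v [ node x (us ++ binomialChildren x e) ])
    ↭⟨ labels-reroot (x + 2 ^ e) e v _ ⟩
  upper ++ ((x ∷ labelsᶠ (us ++ binomialChildren x e)) ++ [])
    ≡⟨ cong (λ ls → upper ++ ((x ∷ ls) ++ [])) (labelsᶠ-++ us (binomialChildren x e)) ⟩
  upper ++ (([ x ] ++ labelsᶠ us ++ labelsᶠ (binomialChildren x e)) ++ [])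
    ↭⟨ ↭-Solver.solve 4 (λ U X S C → U ⊕ ((X ⊕ (S ⊕ C)) ⊕ ↭-Solver.id) ⊜ ((X ⊕ C) ⊕ U) ⊕ S) ↭-refl
                       upper [ x ] (labelsᶠ us) (labelsᶠ (binomialChildren x e)) ⟩
  (labels (binomial x e) ++ upper) ++ labelsᶠ us
    ↭⟨ ++⁺ʳ (labelsᶠ us) (++⁺ʳ upper (labels-binomial x e)) ⟩
  (range x (2 ^ e) ++ upper) ++ labelsᶠ us
    ≡⟨ cong (_++ labelsᶠ us) (sym (range-2^suc x e)) ⟩
  range x (2 ^ suc e) ++ labelsᶠ us ∎
  where
  open PermutationReasoning
  upper : List ℕ
  upper = range (x + 2 ^ e) (2 ^ e)
... | no _ = begin
  labels (reroot x e v (us ++ [ binomial (x + 2 ^ e) e ]))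
    ↭⟨ labels-reroot x e v _ ⟩
  range x (2 ^ e) ++ labelsᶠ (us ++ [ binomial (x + 2 ^ e) e ])
    ≡⟨ cong (range x (2 ^ e) ++_) (labelsᶠ-++ us _) ⟩
  range x (2 ^ e) ++ labelsᶠ us ++ labels (binomial (x + 2 ^ e) e) ++ []
    ↭⟨ ++⁺ˡ (range x (2 ^ e)) (++⁺ˡ (labelsᶠ us) (++⁺ʳ [] (labels-binomial (x + 2 ^ e) e))) ⟩
  range x (2 ^ e) ++ labelsᶠ us ++ range (x + 2 ^ e) (2 ^ e) ++ []
    ↭⟨ ↭-Solver.solve 3 (λ L S U → L ⊕ (S ⊕ (U ⊕ ↭-Solver.id)) ⊜ (L ⊕ U) ⊕ S) ↭-refl
                       (range x (2 ^ e)) (labelsᶠ us) (range (x + 2 ^ e) (2 ^ e)) ⟩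
  (range x (2 ^ e) ++ range (x + 2 ^ e) (2 ^ e)) ++ labelsᶠ us
    ≡⟨ cong (_++ labelsᶠ us) (sym (range-2^suc x e)) ⟩
  range x (2 ^ suc e) ++ labelsᶠ us ∎
  where open PermutationReasoning

finishesBy-reroot : ∀ x e v {s} us → FinishesByᶠ s us → e + length us ≤ suc s → FinishesBy (e + s) (reroot x e v us)
finishesBy-reroot x zero    v     us fus _ = fus
finishesBy-reroot x (suc e) v {s} us fus 1+e+q≤1+s with x + 2 ^ e ≤? v
... | yes _ = subst (λ t → FinishesBy t (reroot (x + 2 ^ e) e v [ node x (us ++ binomialChildren x e) ])) (+-suc e s)
    (finishesBy-reroot (x + 2 ^ e) e v [ node x (us ++ binomialChildren x e) ]
      (finishesByᶠ-++ us fus (finishesBy-binomial x e) (≤-trans (≤-reflexive (+-comm q e)) e+q≤s) , tt)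
      (≤-trans (≤-reflexive (+-comm e 1)) (s≤s (≤-trans (m≤m+n e q) (m≤n⇒m≤1+n e+q≤s)))))
  where
  q : ℕ
  q = length us
  e+q≤s : e + q ≤ s
  e+q≤s = ≤-pred 1+e+q≤1+s
... | no _ = subst (λ t → FinishesBy t (reroot x e v (us ++ [ binomial (x + 2 ^ e) e ]))) (+-suc e s)
    (finishesBy-reroot x e v (us ++ [ binomial (x + 2 ^ e) e ])
      (finishesByᶠ-++ us (finishesByᶠ-mono us (n≤1+n s) fus) (finishesBy-binomial (x + 2 ^ e) e , tt)
        (≤-trans (≤-reflexive (+-comm q (suc e))) 1+e+q≤1+s))
      (≤-trans (≤-reflexive (trans (cong (e +_) (trans (length-++ us) (+-comm q 1))) (+-suc e q)))
               (s≤s (m≤n⇒m≤1+n (≤-pred 1+e+q≤1+s)))))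
  where
  q : ℕ
  q = length us

edgesIn-reroot : ∀ {R} → Symmetric R → ∀ x e v {us} → BinomialBlock R x e →
                 All (R x ∘ root) us → All (EdgesIn R) us → EdgesIn R (reroot x e v us)
edgesIn-reroot sym x zero    v _ Rus Eus = node Rus Eus
edgesIn-reroot sym x (suc e) v (link , lower , upper) Rus Eus with x + 2 ^ e ≤? v | edgesIn-binomial x e lower
... | yes _ | node Rch Ech =
  edgesIn-reroot sym (x + 2 ^ e) e v upper (sym link ∷ []) (node (All.++⁺ Rus Rch) (All.++⁺ Eus Ech) ∷ [])
... | no  _ | _ =
  edgesIn-reroot sym x e v lower (All.++⁺ Rus (link ∷ [])) (All.++⁺ Eus (edgesIn-binomial (x + 2 ^ e) e upper ∷ []))

-- Walking down from the block [x, x + 2 ^ (d + m)) to its sub-block of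
-- size 2 ^ m containing v: the halves left aside, largest first, and the
-- start of that sub-block.
siblings : ℕ → ℕ → ℕ → ℕ → Forest
siblings x zero    m v = []
siblings x (suc d) m v with x + 2 ^ (d + m) ≤? v
... | yes _ = binomial x (d + m) ∷ siblings (x + 2 ^ (d + m)) d m v
... | no  _ = binomial (x + 2 ^ (d + m)) (d + m) ∷ siblings x d m v

subblock : ℕ → ℕ → ℕ → ℕ → ℕ
subblock x zero    m v = x
subblock x (suc d) m v with x + 2 ^ (d + m) ≤? v
... | yes _ = subblock (x + 2 ^ (d + m)) d m v
... | no  _ = subblock x d m v

subblock-∋ : ∀ x d m {v} → x ≤ v → v < x + 2 ^ (d + m) → subblock x d m v ≤ v × v < subblock x d m v + 2 ^ m
subblock-∋ x zero    m     x≤v v< = x≤v , v<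
subblock-∋ x (suc d) m {v} x≤v v< with x + 2 ^ (d + m) ≤? v
... | yes x+2^≤v = subblock-∋ (x + 2 ^ (d + m)) d m x+2^≤v (<-upper-half x (d + m) v<)
... | no  x+2^≰v = subblock-∋ x d m x≤v (≰⇒> x+2^≰v)

subblock-start : ∀ x d m → subblock x d m x ≡ x
subblock-start x zero    m = refl
subblock-start x (suc d) m with x + 2 ^ (d + m) ≤? x
... | yes x+2^≤x = contradiction x+2^≤x (<⇒≱ (m<m+n x (m^n>0 2 (d + m))))
... | no  _      = subblock-start x d m

labels-siblings : ∀ x d m v → labelsᶠ (siblings x d m v) ++ range (subblock x d m v) (2 ^ m) ↭ range x (2 ^ (d + m))
labels-siblings x zero    m v = ↭-refl
labels-siblings x (suc d) m v with x + 2 ^ (d + m) ≤? v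
... | yes _ = begin
  (labels (binomial x (d + m)) ++ labelsᶠ rest) ++ range sub (2 ^ m)
    ≡⟨ ++-assoc (labels (binomial x (d + m))) _ _ ⟩
  labels (binomial x (d + m)) ++ labelsᶠ rest ++ range sub (2 ^ m)
    ↭⟨ ++⁺ (labels-binomial x (d + m)) (labels-siblings (x + 2 ^ (d + m)) d m v) ⟩
  range x (2 ^ (d + m)) ++ range (x + 2 ^ (d + m)) (2 ^ (d + m))
    ≡⟨ sym (range-2^suc x (d + m)) ⟩
  range x (2 ^ suc (d + m)) ∎
  where
  open PermutationReasoning
  rest : Forest
  rest = siblings (x + 2 ^ (d + m)) d m v
  sub : ℕ
  sub = subblock (x + 2 ^ (d + m)) d m v
... | no _ = begin
  (labels (binomial (x + 2 ^ (d + m)) (d + m)) ++ labelsᶠ rest) ++ range sub (2 ^ m)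
    ≡⟨ ++-assoc (labels (binomial (x + 2 ^ (d + m)) (d + m))) _ _ ⟩
  labels (binomial (x + 2 ^ (d + m)) (d + m)) ++ labelsᶠ rest ++ range sub (2 ^ m)
    ↭⟨ ++⁺ (labels-binomial (x + 2 ^ (d + m)) (d + m)) (labels-siblings x d m v) ⟩
  range (x + 2 ^ (d + m)) (2 ^ (d + m)) ++ range x (2 ^ (d + m))
    ↭⟨ ++-comm (range (x + 2 ^ (d + m)) (2 ^ (d + m))) _ ⟩
  range x (2 ^ (d + m)) ++ range (x + 2 ^ (d + m)) (2 ^ (d + m))
    ≡⟨ sym (range-2^suc x (d + m)) ⟩
  range x (2 ^ suc (d + m)) ∎
  where
  open PermutationReasoning
  rest : Forest
  rest = siblings x d m v
  sub : ℕ
  sub = subblock x d m v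

finishesBy-siblings : ∀ x d m v → FinishesByᶠ (d + m) (siblings x d m v)
finishesBy-siblings x zero    m v = tt
finishesBy-siblings x (suc d) m v with x + 2 ^ (d + m) ≤? v
... | yes _ = finishesBy-binomial x (d + m) , finishesBy-siblings (x + 2 ^ (d + m)) d m v
... | no  _ = finishesBy-binomial (x + 2 ^ (d + m)) (d + m) , finishesBy-siblings x d m v

length-siblings : ∀ x d m v → length (siblings x d m v) ≡ d
length-siblings x zero    m v = refl
length-siblings x (suc d) m v with x + 2 ^ (d + m) ≤? v
... | yes _ = cong suc (length-siblings (x + 2 ^ (d + m)) d m v)
... | no  _ = cong suc (length-siblings x d m v)

edgesIn-siblings : ∀ {R} x d m v → BinomialBlock R x (d + m) →
                   All (EdgesIn R) (siblings x d m v) × BinomialBlock R (subblock x d m v) m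
edgesIn-siblings x zero    m v block = [] , block
edgesIn-siblings x (suc d) m v (_ , lower , upper) with x + 2 ^ (d + m) ≤? v
... | yes _ = let (Es , block) = edgesIn-siblings (x + 2 ^ (d + m)) d m v upper
              in edgesIn-binomial x (d + m) lower ∷ Es , block
... | no  _ = let (Es , block) = edgesIn-siblings x d m v lower
              in edgesIn-binomial (x + 2 ^ (d + m)) (d + m) upper ∷ Es , block

finishesBy-reroot[] : ∀ x e v {t} → e + e ≤ suc t → FinishesBy t (reroot x e v [])
finishesBy-reroot[] x e v {t} e+e≤1+t = subst (λ t′ → FinishesBy t′ (reroot x e v [])) (m+[n∸m]≡n e≤t)
  (finishesBy-reroot x e v [] tt
    (≤-trans (≤-reflexive (+-identityʳ e)) (≤-trans (m+n≤o⇒m≤o∸n e e+e≤1+t) (≤-reflexive (+-∸-assoc 1 e≤t)))))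
  where
  e≤t : e ≤ t
  e≤t = m+m≤1+n⇒m≤n e e+e≤1+t

weight : List ℕ → ℕ
weight es = sum (map (2 ^_) es)

blocks : ℕ → List ℕ → Forest
blocks o []       = []
blocks o (e ∷ es) = binomial o e ∷ blocks (o + 2 ^ e) es

blocks-++ : ∀ o ys zs → blocks o (ys ++ zs) ≡ blocks o ys ++ blocks (o + weight ys) zs
blocks-++ o []       zs = cong (λ o′ → blocks o′ zs) (sym (+-identityʳ o))
blocks-++ o (y ∷ ys) zs = cong (binomial o y ∷_)
  (trans (blocks-++ (o + 2 ^ y) ys zs) (cong (λ o′ → blocks (o + 2 ^ y) ys ++ blocks o′ zs) (+-assoc o (2 ^ y) (weight ys))))

labels-blocks : ∀ o es → labelsᶠ (blocks o es) ↭ range o (weight es)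
labels-blocks o []       = ↭-refl
labels-blocks o (e ∷ es) =
  ↭-trans (++⁺ (labels-binomial o e) (labels-blocks (o + 2 ^ e) es)) (↭-reflexive (sym (range-++ o (2 ^ e) (weight es))))

DescendingBelow : ℕ → List ℕ → Set
DescendingBelow t []       = ⊤
DescendingBelow t (e ∷ es) = e < t × DescendingBelow e es

descendingBelow-mono : ∀ {t t′} es → t ≤ t′ → DescendingBelow t es → DescendingBelow t′ es
descendingBelow-mono []       _    _          = tt
descendingBelow-mono (e ∷ es) t≤t′ (e<t , des) = ≤-trans e<t t≤t′ , des

descendingBelow-later : ∀ {t y} ys {e zs} → DescendingBelow t (y ∷ ys ++ e ∷ zs) → e < y
descendingBelow-later []        (_ , e<y , _)     = e<y
descendingBelow-later (y′ ∷ ys) (_ , des@(y′<y , _)) = <-trans (descendingBelow-later ys des) y′<y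

finishesBy-blocks : ∀ {t} o es → DescendingBelow t es → FinishesByᶠ t (blocks o es)
finishesBy-blocks         o []       _ = tt
finishesBy-blocks {zero}  o (e ∷ es) (() , _)
finishesBy-blocks {suc t} o (e ∷ es) (s≤s e≤t , des) =
  finishesBy-mono (binomial o e) e≤t (finishesBy-binomial o e) ,
  finishesBy-blocks (o + 2 ^ e) es (descendingBelow-mono es e≤t des)

-- The exponents of the binary digits of s below 2 ^ M, largest first.
bits : ℕ → ℕ → List ℕ
bits zero    s = []
bits (suc M) s with 2 ^ M ≤? s
... | yes _ = M ∷ bits M (s ∸ 2 ^ M)
... | no  _ = bits M s

weight-bits : ∀ M {s} → s < 2 ^ M → weight (bits M s) ≡ s
weight-bits zero    {zero}  _        = refl
weight-bits zero    {suc _} (s≤s ())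
weight-bits (suc M) {s} s<2^1+M with 2 ^ M ≤? s
... | yes 2^M≤s = trans (cong (2 ^ M +_) (weight-bits M rest<2^M)) (m+[n∸m]≡n 2^M≤s)
  where
  rest<2^M : s ∸ 2 ^ M < 2 ^ M
  rest<2^M = +-cancelˡ-< (2 ^ M) _ _
    (≤-trans (≤-reflexive (cong suc (m+[n∸m]≡n 2^M≤s))) (≤-trans s<2^1+M (≤-reflexive (2^suc M))))
... | no  2^M≰s = weight-bits M (≰⇒> 2^M≰s)

descendingBelow-bits : ∀ M s → DescendingBelow M (bits M s)
descendingBelow-bits zero    s = tt
descendingBelow-bits (suc M) s with 2 ^ M ≤? s
... | yes _ = ≤-refl , descendingBelow-bits M (s ∸ 2 ^ M)
... | no  _ = descendingBelow-mono (bits M s) (n≤1+n M) (descendingBelow-bits M s)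

locate : ∀ o es {v} → o ≤ v → v < o + weight es →
         ∃[ ys ] ∃[ e ] ∃[ zs ] es ≡ ys ++ e ∷ zs × o + weight ys ≤ v × v < o + weight ys + 2 ^ e
locate o [] {v} o≤v v<o+0 = contradiction (≤-trans v<o+0 (≤-reflexive (+-identityʳ o))) (≤⇒≯ o≤v)
locate o (e ∷ es) {v} o≤v v< with v <? o + 2 ^ e
... | yes v<o+2^e = [] , e , es , refl , ≤-trans (≤-reflexive (+-identityʳ o)) o≤v ,
                     ≤-trans v<o+2^e (≤-reflexive (cong (_+ 2 ^ e) (sym (+-identityʳ o))))
... | no  v≮o+2^e with locate (o + 2 ^ e) es (≮⇒≥ v≮o+2^e) (≤-trans v< (≤-reflexive (sym (+-assoc o _ _))))
...   | ys , e′ , zs , refl , lo , hi =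
  e ∷ ys , e′ , zs , refl ,
  ≤-trans (≤-reflexive o+[2^e+w]≡) lo , ≤-trans hi (≤-reflexive (cong (_+ 2 ^ e′) (sym o+[2^e+w]≡)))
  where
  o+[2^e+w]≡ : o + (2 ^ e + weight ys) ≡ o + 2 ^ e + weight ys
  o+[2^e+w]≡ = sym (+-assoc o (2 ^ e) (weight ys))

AllBlocks : (ℕ → ℕ → Set) → ℕ → List ℕ → Set
AllBlocks Q o []       = ⊤
AllBlocks Q o (e ∷ es) = Q o e × AllBlocks Q (o + 2 ^ e) es

allBlocks-map : ∀ {Q Q′ : ℕ → ℕ → Set} → (∀ {x e} → Q x e → Q′ x e) →
                ∀ o es → AllBlocks Q o es → AllBlocks Q′ o es
allBlocks-map f o []       _            = tt
allBlocks-map f o (e ∷ es) (qoe , qes) = f qoe , allBlocks-map f (o + 2 ^ e) es qes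

allBlocks-split : ∀ {Q} o ys {e zs} → AllBlocks Q o (ys ++ e ∷ zs) →
  AllBlocks Q o ys × Q (o + weight ys) e × AllBlocks Q (o + weight ys + 2 ^ e) zs
allBlocks-split {Q} o [] {e} {zs} (qe , qzs) =
  tt , subst (λ x → Q x e) (sym (+-identityʳ o)) qe , subst (λ x → AllBlocks Q (x + 2 ^ e) zs) (sym (+-identityʳ o)) qzs
allBlocks-split {Q} o (y ∷ ys) {e} {zs} (qy , qrest) with allBlocks-split (o + 2 ^ y) ys qrest
... | qys , qe , qzs = (qy , qys) , subst (λ x → Q x e) (+-assoc o _ _) qe ,
                       subst (λ x → AllBlocks Q (x + 2 ^ e) zs) (+-assoc o _ _) qzs

edgesIn-blocks : ∀ {R} o es → AllBlocks (BinomialBlock R) o es → All (EdgesIn R) (blocks o es)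
edgesIn-blocks o []       _             = []
edgesIn-blocks o (e ∷ es) (block , rest) = edgesIn-binomial o e block ∷ edgesIn-blocks (o + 2 ^ e) es rest

descendingBelow-middle : ∀ {t} ys {e zs} → DescendingBelow t (ys ++ e ∷ zs) → e < t
descendingBelow-middle []       (e<t , _)     = e<t
descendingBelow-middle (y ∷ ys) des@(y<t , _) = <-trans (descendingBelow-later ys des) y<t

weight-< : ∀ {t} es → DescendingBelow t es → weight es < 2 ^ t
weight-< {t} []       _           = m^n>0 2 t
weight-< {t} (e ∷ es) (e<t , des) = begin-strict
  2 ^ e + weight es   <⟨ +-monoʳ-< (2 ^ e) (weight-< es des) ⟩
  2 ^ e + 2 ^ e       ≡⟨ sym (2^suc e) ⟩
  2 ^ suc e           ≤⟨ ^-monoʳ-≤ 2 e<t ⟩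
  2 ^ t               ∎
  where open ≤-Reasoning

e≤p-by-budget : ∀ {M e p} → M + M ≤ suc (suc e + p) → e < M → e ≤ p
e≤p-by-budget {M} {e} {p} budget e<M = ≤-pred (+-cancelˡ-≤ (suc e) _ _ (begin
  suc e + suc e     ≤⟨ +-mono-≤ e<M e<M ⟩
  M + M             ≤⟨ budget ⟩
  suc (suc e + p)   ≡⟨ sym (+-suc (suc e) p) ⟩
  suc e + suc p     ∎))
  where open ≤-Reasoning

M≤p-by-budget : ∀ {M e p} → M + M ≤ suc (suc e + p) → suc e < M → M ≤ p
M≤p-by-budget {M} {e} {p} budget 1+e<M = +-cancelˡ-≤ M _ _ (begin
  M + M             ≤⟨ budget ⟩
  suc (suc e) + p   ≤⟨ +-monoˡ-≤ p 1+e<M ⟩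
  M + p             ∎)
  where open ≤-Reasoning

-- The blocks after e are smaller than e ≤ p; if some block precedes e,
-- then e + 2 ≤ M and the budget gives M ≤ p.
finishesBy-otherBlocks : ∀ {M p} o ys e zs → M + M ≤ suc (suc e + p) → DescendingBelow M (ys ++ e ∷ zs) →
                         FinishesByᶠ p (blocks o ys ++ blocks (o + weight ys + 2 ^ e) zs)
finishesBy-otherBlocks o [] e zs budget (e<M , des) =
  finishesBy-blocks _ zs (descendingBelow-mono zs (e≤p-by-budget budget e<M) des)
finishesBy-otherBlocks {M} {p} o (y ∷ ys) e zs budget des@(y<M , _) =
  finishesByᶠ-⊆ others⊆ (finishesBy-blocks o (y ∷ ys ++ e ∷ zs) (descendingBelow-mono (y ∷ ys ++ e ∷ zs) M≤p des))
  where
  M≤p : M ≤ p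
  M≤p = M≤p-by-budget budget (≤-trans (s≤s (descendingBelow-later ys des)) y<M)
  others⊆ : blocks o (y ∷ ys) ++ blocks (o + weight (y ∷ ys) + 2 ^ e) zs ⊆ blocks o (y ∷ ys ++ e ∷ zs)
  others⊆ = subst (blocks o (y ∷ ys) ++ blocks (o + weight (y ∷ ys) + 2 ^ e) zs ⊆_) (sym (blocks-++ o (y ∷ ys) (e ∷ zs)))
                  (Sublist.++⁺ (⊆-refl {x = blocks o (y ∷ ys)}) (binomial (o + weight (y ∷ ys)) e ∷ʳ ⊆-refl))

mutual
  -- binomialParent E y is the parent of y in the binomial tree on
  -- [0, 2 ^ E) rooted at 0, i.e. y with its lowest set bit cleared;
  -- upperParent E z is the parent of 2 ^ E + z.
  binomialParent : ℕ → ℕ → ℕ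
  binomialParent zero    _ = 0
  binomialParent (suc E) y with y <? 2 ^ E
  ... | yes _ = binomialParent E y
  ... | no  _ = upperParent E (y ∸ 2 ^ E)

  upperParent : ℕ → ℕ → ℕ
  upperParent E zero    = 0
  upperParent E (suc z) = 2 ^ E + binomialParent E (suc z)

binomialParent-lower : ∀ E {y} → y < 2 ^ E → binomialParent (suc E) y ≡ binomialParent E y
binomialParent-lower E {y} y<2^E with y <? 2 ^ E
... | yes _ = refl
... | no y≮2^E = contradiction y<2^E y≮2^E

binomialParent-upper : ∀ E z → binomialParent (suc E) (2 ^ E + z) ≡ upperParent E z
binomialParent-upper E z with 2 ^ E + z <? 2 ^ E
... | yes lt = contradiction lt (≤⇒≯ (m≤m+n (2 ^ E) z))
... | no _ = cong (upperParent E) (m+n∸m≡n (2 ^ E) z)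

mutual
  binomialParent-< : ∀ E {y} → 1 ≤ y → binomialParent E y < y
  binomialParent-< zero    1≤y = 1≤y
  binomialParent-< (suc E) {y} 1≤y with y <? 2 ^ E
  ... | yes _ = binomialParent-< E 1≤y
  ... | no y≮2^E = subst (upperParent E (y ∸ 2 ^ E) <_) (m+[n∸m]≡n (≮⇒≥ y≮2^E)) (upperParent-< E (y ∸ 2 ^ E))

  upperParent-< : ∀ E z → upperParent E z < 2 ^ E + z
  upperParent-< E zero    = ≤-trans (m^n>0 2 E) (m≤m+n (2 ^ E) 0)
  upperParent-< E (suc z) = +-monoʳ-< (2 ^ E) (binomialParent-< E (s≤s z≤n))

binomialBlock : ∀ {P} x e → 1 ≤ x → (∀ y → 1 ≤ y → y < 2 ^ e → P (x + y) ≡ x + binomialParent e y) →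
                BinomialBlock (SymClosure (Link P)) x e
binomialBlock x zero _ _ = tt
binomialBlock {P} x (suc e) 1≤x parents =
  fwd (inj₂ (+-mono-≤ 1≤x (m^n>0 2 e) , P[x+2^e]≡x)) ,
  binomialBlock x e 1≤x lowerParents ,
  binomialBlock (x + 2 ^ e) e (≤-trans 1≤x (m≤m+n x _)) upperParents
  where
  P[x+2^e]≡x : P (x + 2 ^ e) ≡ x
  P[x+2^e]≡x = begin
    P (x + 2 ^ e)                            ≡⟨ parents (2 ^ e) (m^n>0 2 e) (2^<2^suc e) ⟩
    x + binomialParent (suc e) (2 ^ e)       ≡⟨ cong (λ y → x + binomialParent (suc e) y) (sym (+-identityʳ (2 ^ e))) ⟩
    x + binomialParent (suc e) (2 ^ e + 0)   ≡⟨ cong (x +_) (binomialParent-upper e 0) ⟩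
    x + 0                                    ≡⟨ +-identityʳ x ⟩
    x                                        ∎
    where open ≡-Reasoning
  lowerParents : ∀ y → 1 ≤ y → y < 2 ^ e → P (x + y) ≡ x + binomialParent e y
  lowerParents y 1≤y y<2^e =
    trans (parents y 1≤y (<-trans y<2^e (2^<2^suc e))) (cong (x +_) (binomialParent-lower e y<2^e))
  upperParents : ∀ y → 1 ≤ y → y < 2 ^ e → P (x + 2 ^ e + y) ≡ x + 2 ^ e + binomialParent e y
  upperParents (suc y) _ 1+y<2^e = begin
    P (x + 2 ^ e + suc y)                          ≡⟨ cong P (+-assoc x (2 ^ e) (suc y)) ⟩
    P (x + (2 ^ e + suc y))                        ≡⟨ parents (2 ^ e + suc y) (≤-trans (s≤s z≤n) (m≤n+m (suc y) (2 ^ e)))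
                                                        (≤-trans (+-monoʳ-< (2 ^ e) 1+y<2^e) (≤-reflexive (sym (2^suc e)))) ⟩
    x + binomialParent (suc e) (2 ^ e + suc y)     ≡⟨ cong (x +_) (binomialParent-upper e (suc y)) ⟩
    x + (2 ^ e + binomialParent e (suc y))         ≡⟨ sym (+-assoc x _ _) ⟩
    x + 2 ^ e + binomialParent e (suc y)           ∎
    where open ≡-Reasoning

-- The attachment vertex of o + z in the block [o, o + 2 ^ e): the root o
-- hangs from vertex 1, the rest follow the binomial tree.
attach : ℕ → ℕ → ℕ → ℕ
attach o e zero    = 1
attach o e (suc y) = o + binomialParent e (suc y)

blockParent : ℕ → List ℕ → ℕ → ℕ
blockParent o []       i = 1
blockParent o (e ∷ es) i with i <? o + 2 ^ e
... | yes _ = attach o e (i ∸ o)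
... | no  _ = blockParent (o + 2 ^ e) es i

blockParent-head : ∀ o e es {i} → i < o + 2 ^ e → blockParent o (e ∷ es) i ≡ attach o e (i ∸ o)
blockParent-head o e es {i} i< with i <? o + 2 ^ e
... | yes _  = refl
... | no i≮ = contradiction i< i≮

blockParent-tail : ∀ o e es {i} → o + 2 ^ e ≤ i → blockParent o (e ∷ es) i ≡ blockParent (o + 2 ^ e) es i
blockParent-tail o e es {i} ≤i with i <? o + 2 ^ e
... | yes i< = contradiction ≤i (<⇒≱ i<)
... | no  _  = refl

attach-bounds : ∀ o e z → 1 ≤ o → 2 ≤ o + z → 1 ≤ attach o e z × attach o e z < o + z
attach-bounds o e zero    1≤o 2≤o+0 = ≤-refl , 2≤o+0
attach-bounds o e (suc y) 1≤o _     = ≤-trans 1≤o (m≤m+n o _) , +-monoʳ-< o (binomialParent-< e (s≤s z≤n))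

blockParent-bounds : ∀ o es {i} → 1 ≤ o → o ≤ i → 2 ≤ i → 1 ≤ blockParent o es i × blockParent o es i < i
blockParent-bounds o []       _   _   2≤i = ≤-refl , 2≤i
blockParent-bounds o (e ∷ es) {i} 1≤o o≤i 2≤i with i <? o + 2 ^ e
... | yes _  = subst (λ j → 1 ≤ attach o e (i ∸ o) × attach o e (i ∸ o) < j) (m+[n∸m]≡n o≤i)
                     (attach-bounds o e (i ∸ o) 1≤o (subst (2 ≤_) (sym (m+[n∸m]≡n o≤i)) 2≤i))
... | no i≮ = blockParent-bounds (o + 2 ^ e) es (≤-trans 1≤o (m≤m+n o _)) (≮⇒≥ i≮) 2≤i

RootedBlock : (ℕ → ℕ) → ℕ → ℕ → Set
RootedBlock P x e = BinomialBlock (SymClosure (Link P)) x e × P x ≡ 1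

rootedBlocks : ∀ {P} o es → 1 ≤ o → (∀ i → o ≤ i → P i ≡ blockParent o es i) → AllBlocks (RootedBlock P) o es
rootedBlocks o []       _   _ = tt
rootedBlocks {P} o (e ∷ es) 1≤o agrees =
  (binomialBlock o e 1≤o inBlock , P[o]≡1) , rootedBlocks (o + 2 ^ e) es (≤-trans 1≤o (m≤m+n o _)) agreesLater
  where
  inBlock : ∀ y → 1 ≤ y → y < 2 ^ e → P (o + y) ≡ o + binomialParent e y
  inBlock (suc y) _ 1+y<2^e = begin
    P (o + suc y)                      ≡⟨ agrees (o + suc y) (m≤m+n o _) ⟩
    blockParent o (e ∷ es) (o + suc y) ≡⟨ blockParent-head o e es (+-monoʳ-< o 1+y<2^e) ⟩
    attach o e (o + suc y ∸ o)         ≡⟨ cong (attach o e) (m+n∸m≡n o (suc y)) ⟩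
    o + binomialParent e (suc y)       ∎
    where open ≡-Reasoning
  P[o]≡1 : P o ≡ 1
  P[o]≡1 = begin
    P o                      ≡⟨ agrees o ≤-refl ⟩
    blockParent o (e ∷ es) o ≡⟨ blockParent-head o e es (m<m+n o (m^n>0 2 e)) ⟩
    attach o e (o ∸ o)       ≡⟨ cong (attach o e) (n∸n≡0 o) ⟩
    1                        ∎
    where open ≡-Reasoning
  agreesLater : ∀ i → o + 2 ^ e ≤ i → P i ≡ blockParent (o + 2 ^ e) es i
  agreesLater i ≤i = trans (agrees i (≤-trans (m≤m+n o _) ≤i)) (blockParent-tail o e es ≤i)

-- The broadcast graph

module Construction (K M : ℕ) (es : List ℕ) (es<M : DescendingBelow M es) (2M≤1+K : M + M ≤ suc K)
                    (m : ℕ) (size : 2 + m ≡ 1 + (2 ^ K + weight es)) where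

  P : ℕ → ℕ
  P = blockParent 1 (K ∷ es)

  P-bounds : ∀ {i} → 2 ≤ i → 1 ≤ P i × P i < i
  P-bounds 2≤i = blockParent-bounds 1 (K ∷ es) ≤-refl (≤-trans (s≤s z≤n) 2≤i) 2≤i

  open Fan P (proj₂ ∘ P-bounds) (proj₁ ∘ P-bounds) public

  R : ℕ → ℕ → Set
  R = SymClosure (Link P)

  o₁ : ℕ
  o₁ = 1 + 2 ^ K

  M≤K : M ≤ K
  M≤K = m+m≤1+n⇒m≤n M 2M≤1+K

  rooted : AllBlocks (RootedBlock P) 1 (K ∷ es)
  rooted = rootedBlocks 1 (K ∷ es) ≤-refl (λ _ _ → refl)

  core : BinomialBlock R 1 K
  core = proj₁ (proj₁ rooted)

  extra : AllBlocks (RootedBlock P) o₁ es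
  extra = proj₂ rooted

  range-n : range 0 (2 + m) ≡ 0 ∷ range 1 (2 ^ K) ++ range o₁ (weight es)
  range-n = trans (cong (range 0) size) (cong (0 ∷_) (range-++ 1 (2 ^ K) (weight es)))

  hub⇝ : ∀ {x} → R 0 x
  hub⇝ = fwd (inj₁ refl)

  ⇝hub : ∀ {x} → R x 0
  ⇝hub = bwd (inj₁ refl)

  broadcasts : ∀ {T} → labels T ↭ 0 ∷ range 1 (2 ^ K) ++ range o₁ (weight es) → EdgesIn R T → FinishesBy (suc K) T →
               ∀ v → toℕ v ≡ root T → BroadcastsWithin (fan m) v (suc K)
  broadcasts labels↭ = broadcastTree⇒broadcastsWithin (fan m) (symLink⇒adj m) (↭-trans labels↭ (↭-reflexive (sym range-n)))

  from-hub : ∀ v → toℕ v ≡ 0 → BroadcastsWithin (fan m) v (suc K)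
  from-hub = broadcasts {node 0 (blocks 1 (K ∷ es))}
    (prep 0 (↭-trans (labels-blocks 1 (K ∷ es)) (↭-reflexive (range-++ 1 (2 ^ K) (weight es)))))
    (node (All.tabulate (λ _ → hub⇝)) (edgesIn-blocks 1 (K ∷ es) (allBlocks-map proj₁ 1 (K ∷ es) rooted)))
    (finishesBy-blocks 1 (K ∷ es) (≤-refl , descendingBelow-mono es M≤K es<M))

  from-core : ∀ v → 1 ≤ toℕ v → toℕ v < o₁ → BroadcastsWithin (fan m) v (suc K)
  from-core v 1≤a a<o₁ =
    broadcasts {addFirstChild hub T′} labels↭ edges
      (finishesBy-addFirstChild hub T′ hub-finishes (finishesBy-reroot[] sub M a 2M≤1+K))
      v (sym (trans (root-addFirstChild hub T′) (root-reroot sub M a [] (proj₁ sub∋a) (proj₂ sub∋a))))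
    where
    a d sub : ℕ
    a = toℕ v
    d = K ∸ M
    sub = subblock 1 d M a
    d+M≡K : d + M ≡ K
    d+M≡K = m∸n+n≡m M≤K
    sub∋a : sub ≤ a × a < sub + 2 ^ M
    sub∋a = subblock-∋ 1 d M 1≤a (subst (λ k → a < 1 + 2 ^ k) (sym d+M≡K) a<o₁)
    hub T′ : Tree
    hub = node 0 (siblings 1 d M a ++ blocks o₁ es)
    T′  = reroot sub M a []
    hub-finishes : FinishesBy K hub
    hub-finishes = finishesByᶠ-++ (siblings 1 d M a)
      (subst (λ k → FinishesByᶠ k (siblings 1 d M a)) d+M≡K (finishesBy-siblings 1 d M a))
      (finishesBy-blocks o₁ es es<M)
      (≤-reflexive (trans (cong (_+ M) (length-siblings 1 d M a)) d+M≡K))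
    sibling-edges : All (EdgesIn R) (siblings 1 d M a) × BinomialBlock R sub M
    sibling-edges = edgesIn-siblings 1 d M a (subst (BinomialBlock R 1) (sym d+M≡K) core)
    edges : EdgesIn R (addFirstChild hub T′)
    edges = edgesIn-addFirstChild hub T′ ⇝hub
      (node (All.tabulate (λ _ → hub⇝))
            (All.++⁺ (proj₁ sibling-edges) (edgesIn-blocks o₁ es (allBlocks-map proj₁ o₁ es extra))))
      (edgesIn-reroot (symmetric _) sub M a (proj₂ sibling-edges) [] [])
    labels↭ : labels (addFirstChild hub T′) ↭ 0 ∷ range 1 (2 ^ K) ++ range o₁ (weight es)
    labels↭ = begin
      labels (addFirstChild hub T′)
        ↭⟨ labels-addFirstChild hub T′ ⟩
      (0 ∷ labelsᶠ (siblings 1 d M a ++ blocks o₁ es)) ++ labels T′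
        ≡⟨ cong (λ ls → (0 ∷ ls) ++ labels T′) (labelsᶠ-++ (siblings 1 d M a) (blocks o₁ es)) ⟩
      ([ 0 ] ++ labelsᶠ (siblings 1 d M a) ++ labelsᶠ (blocks o₁ es)) ++ labels T′
        ↭⟨ ++⁺ˡ (0 ∷ _) (labels-reroot sub M a []) ⟩
      ([ 0 ] ++ labelsᶠ (siblings 1 d M a) ++ labelsᶠ (blocks o₁ es)) ++ range sub (2 ^ M) ++ []
        ↭⟨ ↭-Solver.solve 4 (λ Z S B U → (Z ⊕ (S ⊕ B)) ⊕ (U ⊕ ↭-Solver.id) ⊜ Z ⊕ ((S ⊕ U) ⊕ B)) ↭-refl
             [ 0 ] (labelsᶠ (siblings 1 d M a)) (labelsᶠ (blocks o₁ es)) (range sub (2 ^ M)) ⟩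
      0 ∷ (labelsᶠ (siblings 1 d M a) ++ range sub (2 ^ M)) ++ labelsᶠ (blocks o₁ es)
        ↭⟨ prep 0 (++⁺ (labels-siblings 1 d M a) (labels-blocks o₁ es)) ⟩
      0 ∷ range 1 (2 ^ (d + M)) ++ range o₁ (weight es)
        ≡⟨ cong (λ k → 0 ∷ range 1 (2 ^ k) ++ range o₁ (weight es)) d+M≡K ⟩
      0 ∷ range 1 (2 ^ K) ++ range o₁ (weight es) ∎
      where open PermutationReasoning

  from-extra : ∀ v → o₁ ≤ toℕ v → BroadcastsWithin (fan m) v (suc K)
  from-extra v o₁≤a with locate o₁ es o₁≤a (≤-trans (toℕ<n v) (≤-reflexive size))
  ... | ys , e , zs , es≡ , x≤a , a<x+2^e =
    broadcasts {addFirstChild hub T′} labels↭ edges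
      (finishesBy-addFirstChild hub T′ hub-finishes T′-finishes)
      v (sym (trans (root-addFirstChild hub T′) (root-reroot x e a _ x≤a a<x+2^e)))
    where
    a x p : ℕ
    a = toℕ v
    x = o₁ + weight ys
    p = K ∸ suc e
    des : DescendingBelow M (ys ++ e ∷ zs)
    des = subst (DescendingBelow M) es≡ es<M
    1+e+p≡K : suc e + p ≡ K
    1+e+p≡K = m+[n∸m]≡n (≤-trans (descendingBelow-middle ys des) M≤K)
    budget : M + M ≤ suc (suc e + p)
    budget = subst (λ k → M + M ≤ suc k) (sym 1+e+p≡K) 2M≤1+K
    others : Forest
    others = blocks o₁ ys ++ blocks (x + 2 ^ e) zs
    hub T′ : Tree
    hub = node 0 (siblings 1 (suc e) p 1 ++ others)
    T′  = reroot x e a [ binomial 1 p ]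
    hub-finishes : FinishesBy K hub
    hub-finishes = finishesByᶠ-++ (siblings 1 (suc e) p 1)
      (subst (λ k → FinishesByᶠ k (siblings 1 (suc e) p 1)) 1+e+p≡K (finishesBy-siblings 1 (suc e) p 1))
      (finishesBy-otherBlocks o₁ ys e zs budget des)
      (≤-reflexive (trans (cong (_+ p) (length-siblings 1 (suc e) p 1)) 1+e+p≡K))
    T′-finishes : FinishesBy K T′
    T′-finishes = subst (λ k → FinishesBy k T′) (trans (+-suc e p) 1+e+p≡K)
      (finishesBy-reroot x e a [ binomial 1 p ] (finishesBy-binomial 1 p , tt)
        (≤-trans (≤-reflexive (+-comm e 1)) (s≤s (m≤n⇒m≤1+n (e≤p-by-budget budget (descendingBelow-middle ys des))))))
    split : AllBlocks (RootedBlock P) o₁ ys × RootedBlock P x e × AllBlocks (RootedBlock P) (x + 2 ^ e) zs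
    split = allBlocks-split o₁ ys (subst (AllBlocks (RootedBlock P) o₁) es≡ extra)
    sibling-edges : All (EdgesIn R) (siblings 1 (suc e) p 1) × BinomialBlock R (subblock 1 (suc e) p 1) p
    sibling-edges = edgesIn-siblings 1 (suc e) p 1 (subst (BinomialBlock R 1) (sym 1+e+p≡K) core)
    bottom : BinomialBlock R 1 p
    bottom = subst (λ y → BinomialBlock R y p) (subblock-start 1 (suc e) p) (proj₂ sibling-edges)
    2≤x : 2 ≤ x
    2≤x = s≤s (≤-trans (m^n>0 2 K) (m≤m+n _ _))
    edges : EdgesIn R (addFirstChild hub T′)
    edges = edgesIn-addFirstChild hub T′ ⇝hub
      (node (All.tabulate (λ _ → hub⇝))
            (All.++⁺ (proj₁ sibling-edges)
                     (All.++⁺ (edgesIn-blocks o₁ ys (allBlocks-map proj₁ o₁ ys (proj₁ split)))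
                              (edgesIn-blocks (x + 2 ^ e) zs (allBlocks-map proj₁ _ zs (proj₂ (proj₂ split)))))))
      (edgesIn-reroot (symmetric _) x e a (proj₁ (proj₁ (proj₂ split)))
        (bwd (inj₂ (2≤x , proj₂ (proj₁ (proj₂ split)))) ∷ []) (edgesIn-binomial 1 p bottom ∷ []))
    labels↭ : labels (addFirstChild hub T′) ↭ 0 ∷ range 1 (2 ^ K) ++ range o₁ (weight es)
    labels↭ = begin
      labels (addFirstChild hub T′)
        ↭⟨ labels-addFirstChild hub T′ ⟩
      (0 ∷ labelsᶠ (siblings 1 (suc e) p 1 ++ others)) ++ labels T′
        ≡⟨ cong (λ ls → (0 ∷ ls) ++ labels T′)
             (trans (labelsᶠ-++ (siblings 1 (suc e) p 1) others)
                    (cong (labelsᶠ (siblings 1 (suc e) p 1) ++_) (labelsᶠ-++ (blocks o₁ ys) _))) ⟩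
      ([ 0 ] ++ S ++ Bys ++ Bzs) ++ labels T′
        ↭⟨ ++⁺ˡ (0 ∷ _) (labels-reroot x e a _) ⟩
      ([ 0 ] ++ S ++ Bys ++ Bzs) ++ range x (2 ^ e) ++ labels (binomial 1 p) ++ []
        ↭⟨ ↭-Solver.solve 6 (λ Z S Bys Bzs X B → (Z ⊕ (S ⊕ (Bys ⊕ Bzs))) ⊕ (X ⊕ (B ⊕ ↭-Solver.id))
                                               ⊜ Z ⊕ ((S ⊕ B) ⊕ (Bys ⊕ (X ⊕ Bzs)))) ↭-refl
             [ 0 ] S Bys Bzs (range x (2 ^ e)) (labels (binomial 1 p)) ⟩
      0 ∷ (S ++ labels (binomial 1 p)) ++ Bys ++ range x (2 ^ e) ++ Bzs
        ↭⟨ prep 0 (++⁺ core-labels extra-labels) ⟩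
      0 ∷ range 1 (2 ^ (suc e + p)) ++ range o₁ (weight es)
        ≡⟨ cong (λ k → 0 ∷ range 1 (2 ^ k) ++ range o₁ (weight es)) 1+e+p≡K ⟩
      0 ∷ range 1 (2 ^ K) ++ range o₁ (weight es) ∎
      where
      open PermutationReasoning
      S Bys Bzs : List ℕ
      S   = labelsᶠ (siblings 1 (suc e) p 1)
      Bys = labelsᶠ (blocks o₁ ys)
      Bzs = labelsᶠ (blocks (x + 2 ^ e) zs)
      core-labels : S ++ labels (binomial 1 p) ↭ range 1 (2 ^ (suc e + p))
      core-labels = ↭-trans
        (++⁺ˡ S (↭-trans (labels-binomial 1 p) (↭-reflexive (cong (λ y → range y (2 ^ p)) (sym (subblock-start 1 (suc e) p))))))
        (labels-siblings 1 (suc e) p 1)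
      extra-labels : Bys ++ range x (2 ^ e) ++ Bzs ↭ range o₁ (weight es)
      extra-labels = begin
        Bys ++ range x (2 ^ e) ++ Bzs
          ↭⟨ ++⁺ˡ Bys (++⁺ʳ Bzs (↭-sym (labels-binomial x e))) ⟩
        Bys ++ labelsᶠ (binomial x e ∷ blocks (x + 2 ^ e) zs)
          ≡⟨ sym (labelsᶠ-++ (blocks o₁ ys) _) ⟩
        labelsᶠ (blocks o₁ ys ++ binomial x e ∷ blocks (x + 2 ^ e) zs)
          ≡⟨ cong labelsᶠ (sym (trans (cong (blocks o₁) es≡) (blocks-++ o₁ ys (e ∷ zs)))) ⟩
        labelsᶠ (blocks o₁ es)
          ↭⟨ labels-blocks o₁ es ⟩
        range o₁ (weight es) ∎

  from-anywhere : ∀ v → BroadcastsWithin (fan m) v (suc K)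
  from-anywhere v with toℕ v ≟ 0 | toℕ v <? o₁
  ... | yes a≡0 | _        = from-hub v a≡0
  ... | no  a≢0 | yes a<o₁ = from-core v (n≢0⇒n>0 a≢0) a<o₁
  ... | no  _   | no  a≮o₁ = from-extra v (≮⇒≥ a≮o₁)

  2^K<n : 2 ^ K < 2 + m
  2^K<n = ≤-trans (s≤s (m≤m+n (2 ^ K) (weight es))) (≤-reflexive (sym size))

  n≤2^1+K : 2 + m ≤ 2 ^ suc K
  n≤2^1+K = begin
    2 + m                   ≡⟨ size ⟩
    1 + (2 ^ K + weight es) ≡⟨ cong suc (+-comm (2 ^ K) (weight es)) ⟩
    1 + weight es + 2 ^ K   ≤⟨ +-monoˡ-≤ (2 ^ K) (≤-trans (weight-< es es<M) (^-monoʳ-≤ 2 M≤K)) ⟩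
    2 ^ K + 2 ^ K           ≡⟨ sym (2^suc K) ⟩
    2 ^ suc K               ∎
    where open ≤-Reasoning

  fan-broadcastGraph : IsBroadcastGraph (fan m)
  fan-broadcastGraph =
    fan-connected m ,
    subst (BroadcastTime (fan m)) (sym (⌈log₂⌉-exact K 2^K<n n≤2^1+K))
      (from-anywhere , f0 , from-anywhere f0 , λ t t<1+K B →
        <⇒≱ 2^K<n (≤-trans (broadcastsWithin⇒≤2^ B) (^-monoʳ-≤ 2 (≤-pred t<1+K))))

2^k+1≰n : ∀ k {n} → n ≤ 1 → ¬ (2 ^ k + 1 ≤ n)
2^k+1≰n k n≤1 2^k+1≤n = <⇒≱ (s≤s (m^n>0 2 k)) (≤-trans (≤-reflexive (+-comm 1 (2 ^ k))) (≤-trans 2^k+1≤n n≤1))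

theorem6 : ∀ (k n : ℕ) → 1 ≤ k → 2 ^ (k ∸ 1) + 1 ≤ n → n ≤ 2 ^ (k ∸ 1) + 2 ^ (k / 2) →
    ∃[ E ] (SP n E × Simple E × IsBroadcastGraph E)
theorem6 (suc K) zero          _ lo _  = contradiction lo (2^k+1≰n K z≤n)
theorem6 (suc K) (suc zero)    _ lo _  = contradiction lo (2^k+1≰n K ≤-refl)
theorem6 (suc K) (suc (suc m)) _ lo hi = fan m , fan-SP m , fan-simple m , fan-broadcastGraph
  where
  M s : ℕ
  M = suc K / 2
  s = suc m ∸ 2 ^ K
  2^K≤1+m : 2 ^ K ≤ suc m
  2^K≤1+m = ≤-pred (≤-trans (≤-reflexive (+-comm 1 (2 ^ K))) lo)
  s<2^M : s < 2 ^ M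
  s<2^M = +-cancelˡ-≤ (2 ^ K) _ _ (≤-trans (≤-reflexive (trans (+-suc (2 ^ K) s) (cong suc (m+[n∸m]≡n 2^K≤1+m)))) hi)
  2M≤1+K : M + M ≤ suc K
  2M≤1+K = ≤-trans (≤-reflexive (trans (cong (M +_) (sym (+-identityʳ M))) (*-comm 2 M))) (m/n*n≤m (suc K) 2)
  size : 2 + m ≡ 1 + (2 ^ K + weight (bits M s))
  size = cong suc (trans (sym (m+[n∸m]≡n 2^K≤1+m)) (cong (2 ^ K +_) (sym (weight-bits M s<2^M))))
  open Construction K M (bits M s) (descendingBelow-bits M s) 2M≤1+K m size
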